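{- Let $H$ be a type B or type C Hessenberg space and let $H'=H\cap(\Delta\cup\{s_i(\alpha_j): i\neq j\})$. Then $\mathcal{M}_H^1=\mathcal{M}_{H'}^1$.
   Context: Let $n\ge 2$, $[n]=\{1,\dots,n\}$, $[\bar n]=\{\pm1,\dots,\pm n\}$, $\bar i=-i$. $\mathfrak{W}_n$ is the group of bijections $w$ of $[\bar n]$ with $w(\bar i)=\overline{w(i)}$. For $p,q\in[\bar n]$, $q\ne\pm p$, $(p,q)$ exchanges $p\leftrightarrow q$, $\bar p\leftrightarrow\bar q$; $(p,\bar p)$ exchanges $p,\bar p$. Roots: type B $\Phi^+=\{e_i\pm e_j:1\le i<j\le n\}\cup\{e_i\}$, $\alpha_i=e_i-e_{i+1}$ ($i<n$), $\alpha_n=e_n$; type C $\Phi^+=\{e_i\pm e_j\}\cup\{2e_i\}$, $\alpha_n=2e_n$; $\Delta=\{\alpha_1,\dots,\alpha_n\}$; $s_i$ is the simple reflection of $\alpha_i$ acting on $\mathbb{R}^n$. Explicitly $\Delta\cup\{s_i(\alpha_j):i\ne j\}$ is $\Delta\cup\{\alpha_i+\alpha_{i+1}:i\in[n-1]\}\cup\{\alpha_{n-1}+2\alpha_n\}$ in type B and $\Delta\cup\{\alpha_i+\alpha_{i+1}:i\in[n-1]\}\cup\{2\alpha_{n-1}+\alpha_n\}$ in type C. $\alpha\le\beta$ iff $\beta-\alpha$ is a nonnegative integer combination of simple roots. A Hessenberg space is a lower order ideal $H\supseteq\Delta$ of $\Phi^+$. Reflections: $e_i-e_j\mapsto(i,j)$,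 $e_i+e_j\mapsto(i,\bar j)$, $e_i$ or $2e_i\mapsto(i,\bar i)$; for a set $K$ of positive roots, $S(K)$ is the set of reflections of roots in $K$. With $x_{\bar k}:=-x_k$, $\mathcal{M}_K$ is the set of $\rho:\mathfrak{W}_n\to\mathbb{C}[x_1,\dots,x_n]$ with $\rho(w)-\rho(ws)\in\langle x_{w(p)}-x_{w(q)}\rangle$ for all $w$ and every $s\in S(K)$ exchanging $p$ and $q$ ($q\neq p$, possibly $q=\bar p$); $\mathcal{M}_K^1$ is the subspace of those whose values are all linear forms (or $0$). -}

module Defs where

open import Level using (Level; _⊔_) renaming (suc to lsuc; zero to 0ℓ)
open import Data.Nat as ℕ using (ℕ; zero; suc)
open import Data.Integer as ℤ using (ℤ; +_)
open import Data.Fin as Fin using (Fin; toℕ)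
open import Data.Bool using (Bool; true; false; if_then_else_)
open import Data.Product using (Σ; ∃; ∃-syntax; _×_; _,_; proj₁; proj₂)
open import Data.Sum using (_⊎_)
open import Data.Vec using (Vec; lookup)
open import Relation.Nullary using (¬_; does)
open import Relation.Binary.PropositionalEquality using (_≡_; _≢_)
open import Relation.Unary using (Pred)
open import Algebra.Bundles using (CommutativeRing)

embℕ : ∀ {c ℓ} (R : CommutativeRing c ℓ) → ℕ → CommutativeRing.Carrier R
embℕ R zero    = CommutativeRing.0# R
embℕ R (suc m) = CommutativeRing._+_ R (CommutativeRing.1# R) (embℕ R m)

record CharZeroField (c ℓ : Level) : Set (lsuc (c ⊔ ℓ)) where
  field
    commRing : CommutativeRing c ℓ
  open CommutativeRing commRing public hiding (ring)
  field
    inverse  : ∀ x → ¬ (x ≈ 0#) → Σ Carrier (λ y → x * y ≈ 1#)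
    charZero : ∀ m → ¬ (embℕ commRing (suc m) ≈ 0#)

-- Signed indices [n̄] = {±1,…,±n}: (b , i) stands for i if b = false
-- and for ī = -i if b = true.

SIdx : ℕ → Set
SIdx n = Bool × Fin n

bar : ∀ {n} → SIdx n → SIdx n
bar (b , i) = (Data.Bool.not b , i)

pos : ∀ {n} → Fin n → SIdx n
pos i = (false , i)

neg : ∀ {n} → Fin n → SIdx n
neg i = (true , i)

-- An element w is given by its window
-- (w(1),…,w(n)); w(ī) := bar (w(i)).  Such a map is a bijection of [n̄]
-- commuting with bar iff the absolute values |w(i)| are pairwise distinct.
record W (n : ℕ) : Set where
  constructor mkW
  field
    window : Vec (SIdx n) n
    absInj : ∀ i j → proj₂ (lookup window i) ≡ proj₂ (lookup window j) → i ≡ j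

app : ∀ {n} → W n → SIdx n → SIdx n
app w (false , i) = lookup (W.window w) i
app w (true  , i) = bar (lookup (W.window w) i)

data RootType : Set where
  B C : RootType

data PosRoot (n : ℕ) : Set where
  minus : (i j : Fin n) → i Fin.< j → PosRoot n
  plus  : (i j : Fin n) → i Fin.< j → PosRoot n
  unit  : (i : Fin n) → PosRoot n

δ : ∀ {n} → Fin n → Fin n → ℤ
δ i j = if does (i Fin.≟ j) then + 1 else + 0

vec : ∀ {n} → RootType → PosRoot n → Fin n → ℤ
vec t (minus i j _) k = δ i k ℤ.- δ j k
vec t (plus i j _)  k = δ i k ℤ.+ δ j k
vec B (unit i)      k = δ i k
vec C (unit i)      k = + 2 ℤ.* δ i k

-- simple roots α_k (indices 0,…,n-1 for α_1,…,α_n):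
-- α_k = e_k - e_{k+1} for k < n-1, α_{n-1} = e_n (type B) or 2e_n (type C)
isLast : ∀ {n} → Fin n → Bool
isLast {n} k = does (suc (toℕ k) ℕ.≟ n)

simpleVec : ∀ {n} → RootType → Fin n → Fin n → ℤ
simpleVec B k m = if does (k Fin.≟ m) then + 1
                  else (if does (toℕ m ℕ.≟ suc (toℕ k)) then ℤ.- (+ 1) else + 0)
simpleVec C k m = if does (k Fin.≟ m) then (if isLast k then + 2 else + 1)
                  else (if does (toℕ m ℕ.≟ suc (toℕ k)) then ℤ.- (+ 1) else + 0)

sumℤ : ∀ {n} → (Fin n → ℤ) → ℤ
sumℤ {zero}  f = + 0
sumℤ {suc n} f = f Fin.zero ℤ.+ sumℤ (λ i → f (Fin.suc i))

dot : ∀ {n} → (Fin n → ℤ) → (Fin n → ℤ) → ℤ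
dot u v = sumℤ (λ k → u k ℤ.* v k)

_≼[_]_ : ∀ {n} → PosRoot n → RootType → PosRoot n → Set
_≼[_]_ {n} α t β = Σ (Fin n → ℕ) λ c →
  ∀ m → vec t β m ≡ vec t α m ℤ.+ sumℤ (λ k → + (c k) ℤ.* simpleVec t k m)

IsSimple : ∀ {n} → RootType → PosRoot n → Set
IsSimple {n} t α = Σ (Fin n) λ k → ∀ m → vec t α m ≡ simpleVec t k m

-- u = s_i(v), where s_i(v) = v - (2(v·α_i)/(α_i·α_i)) α_i
IsReflOf : ∀ {n} → RootType → Fin n → (Fin n → ℤ) → (Fin n → ℤ) → Set
IsReflOf t i v u = Σ ℤ λ c →
  (c ℤ.* dot (simpleVec t i) (simpleVec t i) ≡ + 2 ℤ.* dot v (simpleVec t i))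
  × (∀ m → u m ≡ v m ℤ.- c ℤ.* simpleVec t i m)

IsSimpleReflOfSimple : ∀ {n} → RootType → PosRoot n → Set
IsSimpleReflOfSimple {n} t α =
  Σ (Fin n) λ i → Σ (Fin n) λ j → i ≢ j × IsReflOf t i (simpleVec t j) (vec t α)

record IsHessenberg {n : ℕ} (t : RootType) (H : Pred (PosRoot n) 0ℓ) : Set where
  field
    simple⊆ : ∀ α → IsSimple t α → H α
    lower   : ∀ α β → α ≼[ t ] β → H β → H α

restrict : ∀ {n} → RootType → Pred (PosRoot n) 0ℓ → Pred (PosRoot n) 0ℓ
restrict t H α = H α × (IsSimple t α ⊎ IsSimpleReflOfSimple t α)

-- Reflections S(K) as elements acting on [n̄], with the pair (p , q)
-- they exchange:  e_i - e_j ↦ (i,j), e_i + e_j ↦ (i, j̄), e_i/2e_i ↦ (i, ī).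

exch : ∀ {n} → PosRoot n → SIdx n × SIdx n
exch (minus i j _) = (pos i , pos j)
exch (plus i j _)  = (pos i , neg j)
exch (unit i)      = (pos i , neg i)

_≟S_ : ∀ {n} (x y : SIdx n) → Bool
(b , i) ≟S (c , j) = does (Data.Bool._≟_ b c) Data.Bool.∧ does (i Fin.≟ j)

transp : ∀ {n} → SIdx n → SIdx n → SIdx n → SIdx n
transp p q x =
  if x ≟S p then q else
  if x ≟S q then p else
  if x ≟S bar p then bar q else
  if x ≟S bar q then bar p else x

reflAct : ∀ {n} → PosRoot n → SIdx n → SIdx n
reflAct α = transp (proj₁ (exch α)) (proj₂ (exch α))

module _ {c ℓ} (F : CharZeroField c ℓ) where
  open CharZeroField F

  LinForm : ℕ → Set c
  LinForm n = Fin n → Carrier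

  xVar : ∀ {n} → SIdx n → LinForm n
  xVar (false , i) k = if does (i Fin.≟ k) then 1# else 0#
  xVar (true  , i) k = if does (i Fin.≟ k) then - 1# else 0#

  -- for a linear form f, f ∈ ⟨x_p - x_q⟩ (degree-1 part of the principal ideal)
  InIdeal : ∀ {n} → LinForm n → SIdx n → SIdx n → Set (c ⊔ ℓ)
  InIdeal f p q = Σ Carrier λ a → ∀ k → f k ≈ a * (xVar p k - xVar q k)

  -- w' = w s  (as maps of [n̄]; enough to compare on 1,…,n)
  IsProd : ∀ {n} → W n → PosRoot n → W n → Set
  IsProd w α w' = ∀ i → app w' (pos i) ≡ app w (reflAct α (pos i))

  InM1 : ∀ {n} → Pred (PosRoot n) 0ℓ → (W n → LinForm n) → Set (c ⊔ ℓ)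
  InM1 K ρ = ∀ w w' α → K α → IsProd w α w' →
    InIdeal (λ k → ρ w k - ρ w' k) (app w (proj₁ (exch α))) (app w (proj₂ (exch α)))

-- Only the edge conditions of roots α ∈ H outside H′ need proof; we induct on a rank of
-- roots.  Factor s_α = s_γ s_β s_γ with γ, β ∈ H of smaller rank.  The three edges
-- w → w s_γ → w s_γ s_β → w s_α write ρ(w) − ρ(w s_α) as a combination of three forms
-- x_a − x_b; for a suitable factorisation they span a plane containing x_{w(p)} − x_{w(q)},
-- where s_α exchanges p and q, and involve a single further coordinate.  A second
-- factorisation avoiding that coordinate shows that ρ(w) − ρ(w s_α) vanishes there, which
-- cuts the plane down to the line.  γ, β ∈ H because H is a lower ideal and each difference
-- of the roots involved is a nonnegative combination of simple roots.
module Submission where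

open import Defs
open import Level using (0ℓ; _⊔_)
open import Algebra.Bundles using (CommutativeRing)
open import Algebra.Solver.Ring.AlmostCommutativeRing
  using (fromCommutativeRing; _-Raw-AlmostCommutative⟶_)
open import Data.Bool as Bool using (Bool; true; false; T)
open import Data.Empty using (⊥-elim)
open import Data.Fin as Fin using (Fin; toℕ)
import Data.Fin.Properties as Finₚ
open import Data.Integer as ℤ using (ℤ; +_; -[1+_])
import Data.Integer.Properties as ℤₚ
open import Data.Integer.Tactic.RingSolver using (solve-∀)
open import Data.List using (List; []; _∷_)
open import Data.List.Relation.Unary.All using (All; []; _∷_)
open import Data.Maybe using (Maybe; just; nothing)
open import Data.Nat as ℕ using (ℕ; zero; suc; _∸_; _≤_)
open import Data.Nat.Induction using (<-wellFounded)
import Data.Nat.Properties as ℕₚ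
open import Data.Product using (Σ; _×_; _,_; proj₁; proj₂)
open import Data.Product.Properties using (≡-dec)
open import Data.Sign as Sign using (Sign)
open import Data.Sum using (_⊎_; inj₁; inj₂)
open import Data.Vec using (lookup; tabulate)
open import Data.Vec.Properties using (lookup∘tabulate)
open import Function using (_∘_)
open import Function.Bundles using (_⇔_; mk⇔)
import Induction.WellFounded as WF
import Relation.Binary.Construct.On as On
open import Relation.Binary.Definitions using (DecidableEquality)
open import Relation.Binary.PropositionalEquality
  using (_≡_; _≢_; refl; sym; trans; cong; cong₂; subst; subst₂; module ≡-Reasoning)
open import Relation.Nullary using (yes; no)
open import Relation.Unary using (Pred)

-- The ring solver of the library needs coefficients with a computable
-- equality; for an abstract commutative ring we take them from ℤ along
-- the canonical map ℤ → R.
module IntegerCoefficientSolver {c ℓ} (R : CommutativeRing c ℓ) where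
  open CommutativeRing R renaming (refl to ≈-refl; sym to ≈-sym; trans to ≈-trans)
  open import Algebra.Properties.Ring ring using (-‿distribˡ-*; -‿distribʳ-*; -‿involutive; -0#≈0#; -‿+-comm)
  open import Algebra.Properties.CommutativeSemigroup +-commutativeSemigroup using (interchange)
  open import Algebra.Properties.Semiring.Mult semiring using (×-homo-+; ×1-homo-*) renaming (_×_ to _×ᴿ_)
  open import Relation.Binary.Reasoning.Setoid setoid

  signed : Sign → Carrier → Carrier
  signed Sign.+ x = x
  signed Sign.- x = - x

  fromℤ : ℤ → Carrier
  fromℤ i = signed (ℤ.sign i) (ℤ.∣ i ∣ ×ᴿ 1#)

  signed-cong : ∀ s {x y} → x ≈ y → signed s x ≈ signed s y
  signed-cong Sign.+ x≈y = x≈y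
  signed-cong Sign.- x≈y = -‿cong x≈y

  signed-* : ∀ s t x y → signed (s Sign.* t) (x * y) ≈ signed s x * signed t y
  signed-* Sign.+ Sign.+ x y = ≈-refl
  signed-* Sign.+ Sign.- x y = -‿distribʳ-* x y
  signed-* Sign.- Sign.+ x y = -‿distribˡ-* x y
  signed-* Sign.- Sign.- x y = begin
    x * y         ≈⟨ -‿involutive (x * y) ⟨
    - - (x * y)   ≈⟨ -‿cong (-‿distribˡ-* x y) ⟩
    - (- x * y)   ≈⟨ -‿distribʳ-* (- x) y ⟩
    - x * - y     ∎

  fromℤ-◃ : ∀ s m → fromℤ (s ℤ.◃ m) ≈ signed s (m ×ᴿ 1#)
  fromℤ-◃ Sign.+ zero    = ≈-refl
  fromℤ-◃ Sign.- zero    = ≈-sym -0#≈0#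
  fromℤ-◃ Sign.+ (suc m) = ≈-refl
  fromℤ-◃ Sign.- (suc m) = ≈-refl

  fromℤ-* : ∀ i j → fromℤ (i ℤ.* j) ≈ fromℤ i * fromℤ j
  fromℤ-* i j = begin
    fromℤ (s ℤ.◃ ℤ.∣ i ∣ ℕ.* ℤ.∣ j ∣)               ≈⟨ fromℤ-◃ s (ℤ.∣ i ∣ ℕ.* ℤ.∣ j ∣) ⟩
    signed s ((ℤ.∣ i ∣ ℕ.* ℤ.∣ j ∣) ×ᴿ 1#)           ≈⟨ signed-cong s (×1-homo-* ℤ.∣ i ∣ ℤ.∣ j ∣) ⟩
    signed s ((ℤ.∣ i ∣ ×ᴿ 1#) * (ℤ.∣ j ∣ ×ᴿ 1#))       ≈⟨ signed-* (ℤ.sign i) (ℤ.sign j) _ _ ⟩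
    fromℤ i * fromℤ j                               ∎
    where s = ℤ.sign i Sign.* ℤ.sign j

  fromℤ-⊖ : ∀ m n → fromℤ (m ℤ.⊖ n) ≈ m ×ᴿ 1# - n ×ᴿ 1#
  fromℤ-⊖ m       zero    = ≈-sym (≈-trans (+-congˡ -0#≈0#) (+-identityʳ _))
  fromℤ-⊖ zero    (suc n) = ≈-sym (+-identityˡ _)
  fromℤ-⊖ (suc m) (suc n) = begin
    fromℤ (suc m ℤ.⊖ suc n)                   ≡⟨ cong fromℤ (ℤₚ.[1+m]⊖[1+n]≡m⊖n m n) ⟩
    fromℤ (m ℤ.⊖ n)                           ≈⟨ fromℤ-⊖ m n ⟩
    a - b                                     ≈⟨ +-identityˡ (a - b) ⟨
    0# + (a - b)                              ≈⟨ +-congʳ (-‿inverseʳ 1#) ⟨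
    (1# - 1#) + (a - b)                       ≈⟨ interchange 1# a (- 1#) (- b) ⟨
    (1# + a) + (- 1# - b)                     ≈⟨ +-congˡ (-‿+-comm 1# b) ⟩
    (1# + a) - (1# + b)                       ∎
    where a = m ×ᴿ 1#; b = n ×ᴿ 1#

  fromℤ-+ : ∀ i j → fromℤ (i ℤ.+ j) ≈ fromℤ i + fromℤ j
  fromℤ-+ (+ m)    (+ n)    = ×-homo-+ 1# m n
  fromℤ-+ (+ m)    -[1+ n ] = fromℤ-⊖ m (suc n)
  fromℤ-+ -[1+ m ] (+ n)    = ≈-trans (fromℤ-⊖ n (suc m)) (+-comm _ _)
  fromℤ-+ -[1+ m ] -[1+ n ] = begin
    - (suc (suc (m ℕ.+ n)) ×ᴿ 1#)              ≡⟨ cong (λ k → - (suc k ×ᴿ 1#)) (ℕₚ.+-suc m n) ⟨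
    - ((suc m ℕ.+ suc n) ×ᴿ 1#)                ≈⟨ -‿cong (×-homo-+ 1# (suc m) (suc n)) ⟩
    - (suc m ×ᴿ 1# + suc n ×ᴿ 1#)               ≈⟨ -‿+-comm _ _ ⟨
    - (suc m ×ᴿ 1#) - suc n ×ᴿ 1#               ∎

  fromℤ-neg : ∀ i → fromℤ (ℤ.- i) ≈ - fromℤ i
  fromℤ-neg (+ zero)  = ≈-sym -0#≈0#
  fromℤ-neg (+ suc n) = ≈-refl
  fromℤ-neg -[1+ n ]  = ≈-sym (-‿involutive _)

  fromℤ-homomorphism : ℤ.+-*-rawRing -Raw-AlmostCommutative⟶ fromCommutativeRing R
  fromℤ-homomorphism = record
    { ⟦_⟧    = fromℤ
    ; +-homo = fromℤ-+
    ; *-homo = fromℤ-*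
    ; -‿homo = fromℤ-neg
    ; 0-homo = ≈-refl
    ; 1-homo = +-identityʳ 1#
    }

  fromℤ-≟ : ∀ i j → Maybe (fromℤ i ≈ fromℤ j)
  fromℤ-≟ i j with i ℤ.≟ j
  ... | yes refl = just ≈-refl
  ... | no _       = nothing

  open import Algebra.Solver.Ring ℤ.+-*-rawRing (fromCommutativeRing R) fromℤ-homomorphism fromℤ-≟ public

-- Signed transpositions and right multiplication in 𝔚ₙ

module _ {n : ℕ} where

  bar-involutive : (x : SIdx n) → bar (bar x) ≡ x
  bar-involutive (false , i) = refl
  bar-involutive (true  , i) = refl

  bar-≢ : (x : SIdx n) → bar x ≢ x
  bar-≢ (false , i) ()
  bar-≢ (true  , i) ()

  bar-injective : {x y : SIdx n} → bar x ≡ bar y → x ≡ y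
  bar-injective {x} {y} e = trans (sym (bar-involutive x)) (trans (cong bar e) (bar-involutive y))

  _≟ᴵ_ : DecidableEquality (SIdx n)
  _≟ᴵ_ = ≡-dec Bool._≟_ Fin._≟_

  ≟S-refl : (x : SIdx n) → x ≟S x ≡ true
  ≟S-refl (b , i) with Bool._≟_ b b | i Fin.≟ i
  ... | yes _ | yes _ = refl
  ... | no b≢b | _    = ⊥-elim (b≢b refl)
  ... | yes _ | no i≢i = ⊥-elim (i≢i refl)

  ≢⇒≟S-false : (x y : SIdx n) → x ≢ y → x ≟S y ≡ false
  ≢⇒≟S-false (b , i) (c , j) x≢y with Bool._≟_ b c | i Fin.≟ j
  ... | yes refl | yes refl = ⊥-elim (x≢y refl)
  ... | yes _    | no _     = refl
  ... | no _     | _        = refl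

  module Transposition (p q : SIdx n) (p≢q : p ≢ q) where

    transp-p : transp p q p ≡ q
    transp-p rewrite ≟S-refl p = refl

    transp-q : transp p q q ≡ p
    transp-q rewrite ≢⇒≟S-false q p (p≢q ∘ sym) | ≟S-refl q = refl

    transp-bar-p : transp p q (bar p) ≡ bar q
    transp-bar-p rewrite ≢⇒≟S-false (bar p) p (bar-≢ p) with bar p ≟ᴵ q
    ... | yes refl rewrite ≟S-refl (bar p) = sym (bar-involutive p)
    ... | no p̄≢q  rewrite ≢⇒≟S-false (bar p) q p̄≢q | ≟S-refl (bar p) = refl

    transp-bar-q : transp p q (bar q) ≡ bar p
    transp-bar-q with bar q ≟ᴵ p
    ... | yes refl rewrite ≟S-refl (bar q) = sym (bar-involutive q)
    ... | no q̄≢p  rewrite ≢⇒≟S-false (bar q) p q̄≢p | ≢⇒≟S-false (bar q) q (bar-≢ q)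
                        | ≢⇒≟S-false (bar q) (bar p) (λ e → p≢q (sym (bar-injective e)))
                        | ≟S-refl (bar q) = refl

    transp-other : ∀ x → x ≢ p → x ≢ q → x ≢ bar p → x ≢ bar q → transp p q x ≡ x
    transp-other x x≢p x≢q x≢p̄ x≢q̄
      rewrite ≢⇒≟S-false x p x≢p | ≢⇒≟S-false x q x≢q
            | ≢⇒≟S-false x (bar p) x≢p̄ | ≢⇒≟S-false x (bar q) x≢q̄ = refl

    data Position (x : SIdx n) : Set where
      at-p     : x ≡ p → Position x
      at-q     : x ≡ q → Position x
      at-bar-p : x ≡ bar p → Position x
      at-bar-q : x ≡ bar q → Position x
      other    : x ≢ p → x ≢ q → x ≢ bar p → x ≢ bar q → Position x

    position : (x : SIdx n) → Position x
    position x with x ≟ᴵ p | x ≟ᴵ q | x ≟ᴵ bar p | x ≟ᴵ bar q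
    ... | yes e | _     | _     | _     = at-p e
    ... | no _  | yes e | _     | _     = at-q e
    ... | no _  | no _  | yes e | _     = at-bar-p e
    ... | no _  | no _  | no _  | yes e = at-bar-q e
    ... | no a  | no b  | no c  | no d  = other a b c d

    transp-involutive : ∀ x → transp p q (transp p q x) ≡ x
    transp-involutive x with position x
    ... | at-p refl     rewrite transp-p     = transp-q
    ... | at-q refl     rewrite transp-q     = transp-p
    ... | at-bar-p refl rewrite transp-bar-p = transp-bar-q
    ... | at-bar-q refl rewrite transp-bar-q = transp-bar-p
    ... | other a b c d rewrite transp-other x a b c d = transp-other x a b c d

    transp-bar : ∀ x → transp p q (bar x) ≡ bar (transp p q x)
    transp-bar x with position x
    ... | at-p refl     rewrite transp-p = transp-bar-p
    ... | at-q refl     rewrite transp-q = transp-bar-q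
    ... | at-bar-p refl = trans (cong (transp p q) (bar-involutive p))
                                (trans transp-p (sym (trans (cong bar transp-bar-p) (bar-involutive q))))
    ... | at-bar-q refl = trans (cong (transp p q) (bar-involutive q))
                                (trans transp-q (sym (trans (cong bar transp-bar-q) (bar-involutive p))))
    ... | other a b c d rewrite transp-other x a b c d =
      transp-other (bar x) (λ e → c (bar-on-left e)) (λ e → d (bar-on-left e))
                           (a ∘ bar-injective) (b ∘ bar-injective)
      where
        bar-on-left : ∀ {y} → bar x ≡ y → x ≡ bar y
        bar-on-left e = trans (sym (bar-involutive x)) (cong bar e)

    transp-unique : (T : SIdx n → SIdx n) → T p ≡ q → T q ≡ p → T (bar p) ≡ bar q → T (bar q) ≡ bar p →
                    (∀ x → x ≢ p → x ≢ q → x ≢ bar p → x ≢ bar q → T x ≡ x) →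
                    ∀ x → T x ≡ transp p q x
    transp-unique T Tp Tq Tp̄ Tq̄ Tother x with position x
    ... | at-p refl     = trans Tp (sym transp-p)
    ... | at-q refl     = trans Tq (sym transp-q)
    ... | at-bar-p refl = trans Tp̄ (sym transp-bar-p)
    ... | at-bar-q refl = trans Tq̄ (sym transp-bar-q)
    ... | other a b c d = trans (Tother x a b c d) (sym (transp-other x a b c d))

  open Transposition

  transp-conjugate : (p q a b : SIdx n) → p ≢ q → a ≢ b →
                     ∀ x → transp p q (transp a b (transp p q x)) ≡ transp (transp p q a) (transp p q b) x
  transp-conjugate p q a b p≢q a≢b =
    transp-unique (σ a) (σ b) σa≢σb (σ ∘ τ ∘ σ)
      (cong σ (trans (cong τ (σ² a)) (transp-p a b a≢b)))
      (cong σ (trans (cong τ (σ² b)) (transp-q a b a≢b)))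
      (trans (cong (σ ∘ τ) (trans (σ-bar (σ a)) (cong bar (σ² a))))
             (trans (cong σ (transp-bar-p a b a≢b)) (σ-bar b)))
      (trans (cong (σ ∘ τ) (trans (σ-bar (σ b)) (cong bar (σ² b))))
             (trans (cong σ (transp-bar-q a b a≢b)) (σ-bar a)))
      fixes
    where
      σ = transp p q
      τ = transp a b
      σ² = transp-involutive p q p≢q
      σ-bar = transp-bar p q p≢q
      σa≢σb : σ a ≢ σ b
      σa≢σb e = a≢b (trans (sym (σ² a)) (trans (cong σ e) (σ² b)))
      fixes : ∀ y → y ≢ σ a → y ≢ σ b → y ≢ bar (σ a) → y ≢ bar (σ b) → σ (τ (σ y)) ≡ y
      fixes y y≢σa y≢σb y≢σā y≢σb̄ = trans (cong σ (transp-other a b a≢b (σ y)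
          (λ e → y≢σa (trans (sym (σ² y)) (cong σ e)))
          (λ e → y≢σb (trans (sym (σ² y)) (cong σ e)))
          (λ e → y≢σā (trans (sym (σ² y)) (trans (cong σ e) (σ-bar a))))
          (λ e → y≢σb̄ (trans (sym (σ² y)) (trans (cong σ e) (σ-bar b))))))
        (σ² y)

  transp-sym : (p q : SIdx n) → p ≢ q → ∀ x → transp q p x ≡ transp p q x
  transp-sym p q p≢q = transp-unique p q p≢q (transp q p)
    (transp-q q p q≢p) (transp-p q p q≢p) (transp-bar-q q p q≢p) (transp-bar-p q p q≢p)
    (λ x a b c d → transp-other q p q≢p x b a d c)
    where q≢p = p≢q ∘ sym

  transp-bar-bar : (p q : SIdx n) → p ≢ q → ∀ x → transp (bar p) (bar q) x ≡ transp p q x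
  transp-bar-bar p q p≢q = transp-unique p q p≢q (transp (bar p) (bar q))
    (trans (cong (transp (bar p) (bar q)) (sym (bar-involutive p)))
           (trans (transp-bar-p (bar p) (bar q) p̄≢q̄) (bar-involutive q)))
    (trans (cong (transp (bar p) (bar q)) (sym (bar-involutive q)))
           (trans (transp-bar-q (bar p) (bar q) p̄≢q̄) (bar-involutive p)))
    (transp-p (bar p) (bar q) p̄≢q̄) (transp-q (bar p) (bar q) p̄≢q̄)
    (λ x a b c d → transp-other (bar p) (bar q) p̄≢q̄ x c d
                     (λ e → a (trans e (bar-involutive p))) (λ e → b (trans e (bar-involutive q))))
    where p̄≢q̄ = p≢q ∘ bar-injective

  ∣_∣ : SIdx n → Fin n
  ∣_∣ = proj₂

  ∣∣≡⇒≡⊎≡bar : (x y : SIdx n) → ∣ x ∣ ≡ ∣ y ∣ → x ≡ y ⊎ x ≡ bar y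
  ∣∣≡⇒≡⊎≡bar (false , i) (false , .i) refl = inj₁ refl
  ∣∣≡⇒≡⊎≡bar (false , i) (true  , .i) refl = inj₂ refl
  ∣∣≡⇒≡⊎≡bar (true  , i) (false , .i) refl = inj₂ refl
  ∣∣≡⇒≡⊎≡bar (true  , i) (true  , .i) refl = inj₁ refl

  app-bar : (w : W n) (x : SIdx n) → app w (bar x) ≡ bar (app w x)
  app-bar w (false , i) = refl
  app-bar w (true  , i) = sym (bar-involutive _)

  app-∣∣-injective : (w : W n) (x y : SIdx n) → ∣ app w x ∣ ≡ ∣ app w y ∣ → ∣ x ∣ ≡ ∣ y ∣
  app-∣∣-injective w (false , i) (false , j) = W.absInj w i j
  app-∣∣-injective w (false , i) (true  , j) = W.absInj w i j
  app-∣∣-injective w (true  , i) (false , j) = W.absInj w i j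
  app-∣∣-injective w (true  , i) (true  , j) = W.absInj w i j

  _·⟨_,_⟩ : W n → (p q : SIdx n) → p ≢ q → W n
  (w ·⟨ p , q ⟩) p≢q = mkW window injective
    where
      s = transp p q
      s² = transp-involutive p q p≢q
      window = tabulate (λ i → app w (s (pos i)))
      injective : ∀ i j → ∣ lookup window i ∣ ≡ ∣ lookup window j ∣ → i ≡ j
      injective i j e with ∣∣≡⇒≡⊎≡bar (s (pos i)) (s (pos j)) (app-∣∣-injective w (s (pos i)) (s (pos j))
        (trans (sym (cong ∣_∣ (lookup∘tabulate (λ i → app w (s (pos i))) i)))
               (trans e (cong ∣_∣ (lookup∘tabulate (λ i → app w (s (pos i))) j)))))
      ... | inj₁ e = cong ∣_∣ (trans (sym (s² (pos i))) (trans (cong s e) (s² (pos j))))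
      ... | inj₂ e = cong ∣_∣ (trans (sym (s² (pos i)))
                       (trans (cong s e) (trans (transp-bar p q p≢q (s (pos j))) (cong bar (s² (pos j))))))

  app-· : (w : W n) (p q : SIdx n) (p≢q : p ≢ q) → ∀ x → app ((w ·⟨ p , q ⟩) p≢q) x ≡ app w (transp p q x)
  app-· w p q p≢q (false , i) = lookup∘tabulate (λ i → app w (transp p q (pos i))) i
  app-· w p q p≢q (true  , i) =
    trans (cong bar (lookup∘tabulate (λ i → app w (transp p q (pos i))) i))
          (trans (sym (app-bar w (transp p q (pos i)))) (cong (app w) (sym (transp-bar p q p≢q (pos i)))))

  app-∣∣-≢ : (w : W n) (x y : SIdx n) → ∣ x ∣ ≢ ∣ y ∣ → ∣ app w x ∣ ≢ ∣ app w y ∣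
  app-∣∣-≢ w x y x≢y = x≢y ∘ app-∣∣-injective w x y

-- Factorisations s_α = s_γ s_β s_γ and the edge conditions

module _ {n : ℕ} where

  P Q : PosRoot n → SIdx n
  P α = proj₁ (exch α)
  Q α = proj₂ (exch α)

  P≢Q : (α : PosRoot n) → P α ≢ Q α
  P≢Q (minus i j i<j) e = ℕₚ.<-irrefl (cong (toℕ ∘ proj₂) e) i<j
  P≢Q (plus i j _) ()
  P≢Q (unit i) ()

  _·_ : W n → PosRoot n → W n
  w · α = (w ·⟨ P α , Q α ⟩) (P≢Q α)

  data Parallel : SIdx n → SIdx n → SIdx n → SIdx n → Set where
    same     : ∀ {p q} → Parallel p q p q
    reversed : ∀ {p q} → Parallel (bar q) (bar p) p q

  Parallel-avoids : ∀ {a b p q z} → Parallel a b p q → ∣ a ∣ ≢ z → ∣ b ∣ ≢ z → ∣ p ∣ ≢ z × ∣ q ∣ ≢ z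
  Parallel-avoids same     a≢z b≢z = a≢z , b≢z
  Parallel-avoids reversed a≢z b≢z = b≢z , a≢z

  Parallel⇒transp : ∀ {a b p q} → Parallel a b p q → p ≢ q → ∀ x → transp a b x ≡ transp p q x
  Parallel⇒transp same     p≢q x = refl
  Parallel⇒transp (reversed {p} {q}) p≢q x =
    trans (transp-sym (bar p) (bar q) (p≢q ∘ bar-injective) x) (transp-bar-bar p q p≢q x)

  -- s_α = s_γ s_β s_γ; the points record the pairs exchanged by the three
  -- steps  w → w s_γ → w s_γ s_β → w s_γ s_β s_γ,  pulled back along w
  record Factorisation (α : PosRoot n) : Set where
    field
      γ β         : PosRoot n
      p₂ q₂ p₃ q₃ : SIdx n
      γ-P-β       : reflAct γ (P β) ≡ p₂
      γ-Q-β       : reflAct γ (Q β) ≡ q₂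
      γβ-P-γ      : reflAct γ (reflAct β (P γ)) ≡ p₃
      γβ-Q-γ      : reflAct γ (reflAct β (Q γ)) ≡ q₃
      parallel    : Parallel p₂ q₂ (P α) (Q α)

    conjugates : ∀ x → reflAct γ (reflAct β (reflAct γ x)) ≡ reflAct α x
    conjugates x = begin
      reflAct γ (reflAct β (reflAct γ x))            ≡⟨ transp-conjugate _ _ _ _ (P≢Q γ) (P≢Q β) x ⟩
      transp (reflAct γ (P β)) (reflAct γ (Q β)) x   ≡⟨ cong₂ (λ a b → transp a b x) γ-P-β γ-Q-β ⟩
      transp p₂ q₂ x                                 ≡⟨ Parallel⇒transp parallel (P≢Q α) x ⟩
      reflAct α x                                    ∎
      where open ≡-Reasoning

    points : List (SIdx n)
    points = P γ ∷ Q γ ∷ p₂ ∷ q₂ ∷ p₃ ∷ q₃ ∷ []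

    -- the three steps run through P α, Q α and the single further point Q γ
    Adapted : Set
    Adapted = P γ ≡ P α × p₃ ≡ Q γ × q₃ ≡ Q α

module LinearForms {c ℓ} (F : CharZeroField c ℓ) {n : ℕ} where
  open CharZeroField F renaming (refl to ≈-refl; sym to ≈-sym; trans to ≈-trans)
  open import Algebra.Properties.Ring (CommutativeRing.ring commRing) using (-0#≈0#; -‿involutive; -1*x≈-x)
  open IntegerCoefficientSolver commRing using (solve; _:=_; _:-_; :-_)
  open import Relation.Binary.Reasoning.Setoid setoid

  dx : SIdx n → SIdx n → LinForm F n
  dx a b k = xVar F a k - xVar F b k

  Span₂ : (f L U : LinForm F n) → Set (c ⊔ ℓ)
  Span₂ f L U = Σ Carrier λ a → Σ Carrier λ b → ∀ k → f k ≈ a * L k + b * U k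

  Span₃ : (f L₁ L₂ L₃ : LinForm F n) → Set (c ⊔ ℓ)
  Span₃ f L₁ L₂ L₃ = Σ Carrier λ a₁ → Σ Carrier λ a₂ → Σ Carrier λ a₃ →
                     ∀ k → f k ≈ a₁ * L₁ k + (a₂ * L₂ k + a₃ * L₃ k)

  xVar-∣∣ : (v : SIdx n) → xVar F v ∣ v ∣ ≈ 1# ⊎ xVar F v ∣ v ∣ ≈ - 1#
  xVar-∣∣ (false , i) with i Fin.≟ i
  ... | yes _   = inj₁ ≈-refl
  ... | no i≢i = ⊥-elim (i≢i refl)
  xVar-∣∣ (true , i) with i Fin.≟ i
  ... | yes _   = inj₂ ≈-refl
  ... | no i≢i = ⊥-elim (i≢i refl)

  xVar-off : (v : SIdx n) (k : Fin n) → ∣ v ∣ ≢ k → xVar F v k ≈ 0#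
  xVar-off (false , i) k i≢k with i Fin.≟ k
  ... | yes i≡k = ⊥-elim (i≢k i≡k)
  ... | no _    = ≈-refl
  xVar-off (true , i) k i≢k with i Fin.≟ k
  ... | yes i≡k = ⊥-elim (i≢k i≡k)
  ... | no _    = ≈-refl

  xVar-bar : (v : SIdx n) (k : Fin n) → xVar F (bar v) k ≈ - xVar F v k
  xVar-bar (false , i) k with i Fin.≟ k
  ... | yes _ = ≈-refl
  ... | no _  = ≈-sym -0#≈0#
  xVar-bar (true , i) k with i Fin.≟ k
  ... | yes _ = ≈-sym (-‿involutive 1#)
  ... | no _  = ≈-sym -0#≈0#

  dx-off : ∀ a b {k} → ∣ a ∣ ≢ k → ∣ b ∣ ≢ k → dx a b k ≈ 0#
  dx-off a b {k} a≢k b≢k = begin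
    xVar F a k - xVar F b k   ≈⟨ +-cong (xVar-off a k a≢k) (-‿cong (xVar-off b k b≢k)) ⟩
    0# - 0#                   ≈⟨ -‿inverseʳ 0# ⟩
    0#                        ∎

  dx-∣∣ : ∀ a b → ∣ a ∣ ≢ ∣ b ∣ → dx a b ∣ b ∣ ≈ 1# ⊎ dx a b ∣ b ∣ ≈ - 1#
  dx-∣∣ a b a≢b with xVar-∣∣ b
  ... | inj₁ xb≈1  = inj₂ (≈-trans (+-cong (xVar-off a ∣ b ∣ a≢b) (-‿cong xb≈1)) (+-identityˡ (- 1#)))
  ... | inj₂ xb≈-1 = inj₁ (≈-trans (+-cong (xVar-off a ∣ b ∣ a≢b) (-‿cong xb≈-1))
                                 (≈-trans (+-identityˡ (- - 1#)) (-‿involutive 1#)))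

  dx-reversed : ∀ p q k → dx (bar q) (bar p) k ≈ dx p q k
  dx-reversed p q k = begin
    xVar F (bar q) k - xVar F (bar p) k   ≈⟨ +-cong (xVar-bar q k) (-‿cong (xVar-bar p k)) ⟩
    - xVar F q k - - xVar F p k           ≈⟨ swap (xVar F p k) (xVar F q k) ⟩
    xVar F p k - xVar F q k               ∎
    where
      swap : ∀ x y → - y - - x ≈ x - y
      swap = solve 2 (λ x y → :- y :- :- x := x :- y) ≈-refl

  Span₃-vanishes : ∀ {f L₁ L₂ L₃} k → Span₃ f L₁ L₂ L₃ → L₁ k ≈ 0# → L₂ k ≈ 0# → L₃ k ≈ 0# → f k ≈ 0#
  Span₃-vanishes k (a₁ , a₂ , a₃ , f≈) L₁≈0 L₂≈0 L₃≈0 = begin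
    _                                        ≈⟨ f≈ k ⟩
    a₁ * _ + (a₂ * _ + a₃ * _)               ≈⟨ +-cong (*-congˡ L₁≈0) (+-cong (*-congˡ L₂≈0) (*-congˡ L₃≈0)) ⟩
    a₁ * 0# + (a₂ * 0# + a₃ * 0#)            ≈⟨ +-cong (zeroʳ a₁) (+-cong (zeroʳ a₂) (zeroʳ a₃)) ⟩
    0# + (0# + 0#)                           ≈⟨ ≈-trans (+-identityˡ _) (+-identityʳ 0#) ⟩
    0#                                       ∎

  ±1-cancel : ∀ {u} b → u ≈ 1# ⊎ u ≈ - 1# → b * u ≈ 0# → b ≈ 0#
  ±1-cancel {u} b (inj₁ u≈1) bu≈0 = begin
    b        ≈⟨ *-identityʳ b ⟨
    b * 1#   ≈⟨ *-congˡ u≈1 ⟨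
    b * u    ≈⟨ bu≈0 ⟩
    0#       ∎
  ±1-cancel {u} b (inj₂ u≈-1) bu≈0 = begin
    b             ≈⟨ -‿involutive b ⟨
    - - b         ≈⟨ -‿cong (-1*x≈-x b) ⟨
    - (- 1# * b)  ≈⟨ -‿cong (*-comm (- 1#) b) ⟩
    - (b * - 1#)  ≈⟨ -‿cong (*-congˡ u≈-1) ⟨
    - (b * u)     ≈⟨ -‿cong bu≈0 ⟩
    - 0#          ≈⟨ -0#≈0# ⟩
    0#            ∎

  Span₂-collapse : ∀ {f L U} z → Span₂ f L U → f z ≈ 0# → L z ≈ 0# → U z ≈ 1# ⊎ U z ≈ - 1# →
                   Σ Carrier λ a → ∀ k → f k ≈ a * L k
  Span₂-collapse {f} {L} {U} z (a , b , f≈) fz≈0 Lz≈0 Uz≈±1 = a , λ k → begin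
      f k                  ≈⟨ f≈ k ⟩
      a * L k + b * U k    ≈⟨ +-congˡ (*-congʳ b≈0) ⟩
      a * L k + 0# * U k   ≈⟨ +-congˡ (zeroˡ (U k)) ⟩
      a * L k + 0#         ≈⟨ +-identityʳ (a * L k) ⟩
      a * L k              ∎
    where
      b≈0 : b ≈ 0#
      b≈0 = ±1-cancel b Uz≈±1 (begin
        b * U z              ≈⟨ +-identityˡ (b * U z) ⟨
        0# + b * U z         ≈⟨ +-congʳ (≈-trans (*-congˡ Lz≈0) (zeroʳ a)) ⟨
        a * L z + b * U z    ≈⟨ f≈ z ⟨
        f z                  ≈⟨ fz≈0 ⟩
        0#                   ∎)

  Parallel⇒dx : ∀ {a b p q} → Parallel a b p q → ∀ w k → dx (app w a) (app w b) k ≈ dx (app w p) (app w q) k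
  Parallel⇒dx same                   w k = ≈-refl
  Parallel⇒dx (reversed {p} {q}) w k rewrite app-bar w q | app-bar w p = dx-reversed (app w p) (app w q) k

module EdgeConditions {c ℓ} (F : CharZeroField c ℓ) {n : ℕ} (ρ : W n → LinForm F n) where
  open CharZeroField F renaming (refl to ≈-refl; sym to ≈-sym; trans to ≈-trans)
  open LinearForms F
  open IntegerCoefficientSolver commRing using (solve; _:=_; _:+_; _:-_; _:*_)
  open import Relation.Binary.Reasoning.Setoid setoid

  EdgeCondition : PosRoot n → Set (c ⊔ ℓ)
  EdgeCondition α = ∀ w w' → IsProd F w α w' → InIdeal F (λ k → ρ w k - ρ w' k) (app w (P α)) (app w (Q α))

  ·-IsProd : ∀ (w : W n) α → IsProd F w α (w · α)
  ·-IsProd w α i = app-· w (P α) (Q α) (P≢Q α) (pos i)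

  telescope : ∀ x y z t → x - t ≈ (x - y) + ((y - z) + (z - t))
  telescope = solve 4 (λ x y z t → x :- t := (x :- y) :+ ((y :- z) :+ (z :- t))) ≈-refl

  module _ {α : PosRoot n} (φ : Factorisation α) where
    open Factorisation φ

    decomposition : EdgeCondition γ → EdgeCondition β → ∀ w w' → IsProd F w α w' →
                    Span₃ (λ k → ρ w k - ρ w' k) (dx (app w (P γ)) (app w (Q γ)))
                          (dx (app w p₂) (app w q₂)) (dx (app w p₃) (app w q₃))
    decomposition cond-γ cond-β w w' w'≡ws = proj₁ r₁ , proj₁ r₂ , proj₁ r₃ , λ k → begin
        ρ w k - ρ w' k
          ≈⟨ telescope (ρ w k) (ρ w₁ k) (ρ w₂ k) (ρ w' k) ⟩
        (ρ w k - ρ w₁ k) + ((ρ w₁ k - ρ w₂ k) + (ρ w₂ k - ρ w' k))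
          ≈⟨ +-cong (proj₂ r₁ k) (+-cong (proj₂ r₂ k) (proj₂ r₃ k)) ⟩
        _ ∎
      where
        σ = reflAct γ
        τ = reflAct β
        w₁ = w · γ
        w₂ = w₁ · β
        app-w₁ : ∀ y → app w₁ y ≡ app w (σ y)
        app-w₁ = app-· w (P γ) (Q γ) (P≢Q γ)
        app-w₂ : ∀ y → app w₂ y ≡ app w (σ (τ y))
        app-w₂ y = trans (app-· w₁ (P β) (Q β) (P≢Q β) y) (app-w₁ (τ y))
        w₂-γ-w' : IsProd F w₂ γ w'
        w₂-γ-w' i = trans (w'≡ws i) (trans (cong (app w) (sym (conjugates (pos i))))
                                                (sym (app-w₂ (σ (pos i)))))
        r₁ = cond-γ w w₁ (·-IsProd w γ)
        r₂ = subst₂ (InIdeal F (λ k → ρ w₁ k - ρ w₂ k))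
               (trans (app-w₁ (P β)) (cong (app w) γ-P-β)) (trans (app-w₁ (Q β)) (cong (app w) γ-Q-β))
               (cond-β w₁ w₂ (·-IsProd w₁ β))
        r₃ = subst₂ (InIdeal F (λ k → ρ w₂ k - ρ w' k))
               (trans (app-w₂ (P γ)) (cong (app w) γβ-P-γ)) (trans (app-w₂ (Q γ)) (cong (app w) γβ-Q-γ))
               (cond-γ w₂ w' w₂-γ-w')

    adapted-span : Adapted → EdgeCondition γ → EdgeCondition β → ∀ w w' → IsProd F w α w' →
                   Span₂ (λ k → ρ w k - ρ w' k)
                         (dx (app w (P α)) (app w (Q α))) (dx (app w (P α)) (app w (Q γ)))
    adapted-span (Pγ≡Pα , p₃≡Qγ , q₃≡Qα) cond-γ cond-β w w' w'≡ws = a₂ + a₃ , a₁ - a₃ , λ k → begin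
        ρ w k - ρ w' k
          ≈⟨ D≈ k ⟩
        a₁ * dx (w⟨ P γ ⟩) (w⟨ Q γ ⟩) k + (a₂ * dx (w⟨ p₂ ⟩) (w⟨ q₂ ⟩) k + a₃ * dx (w⟨ p₃ ⟩) (w⟨ q₃ ⟩) k)
          ≈⟨ +-cong (*-congˡ (reflexive (cong (λ u → dx (w⟨ u ⟩) (w⟨ Q γ ⟩) k) Pγ≡Pα)))
                    (+-cong (*-congˡ (Parallel⇒dx parallel w k))
                            (*-congˡ (reflexive (cong₂ (λ u v → dx (w⟨ u ⟩) (w⟨ v ⟩) k) p₃≡Qγ q₃≡Qα)))) ⟩
        a₁ * dx (w⟨ P α ⟩) (w⟨ Q γ ⟩) k + (a₂ * dx (w⟨ P α ⟩) (w⟨ Q α ⟩) k + a₃ * dx (w⟨ Q γ ⟩) (w⟨ Q α ⟩) k)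
          ≈⟨ regroup a₁ a₂ a₃ (x⟨ P α ⟩ k) (x⟨ Q α ⟩ k) (x⟨ Q γ ⟩ k) ⟩
        (a₂ + a₃) * dx (w⟨ P α ⟩) (w⟨ Q α ⟩) k + (a₁ - a₃) * dx (w⟨ P α ⟩) (w⟨ Q γ ⟩) k
          ∎
      where
        w⟨_⟩ = app w
        x⟨_⟩ = λ y → xVar F (app w y)
        D = decomposition cond-γ cond-β w w' w'≡ws
        a₁ = proj₁ D
        a₂ = proj₁ (proj₂ D)
        a₃ = proj₁ (proj₂ (proj₂ D))
        D≈ = proj₂ (proj₂ (proj₂ D))
        regroup : ∀ a₁ a₂ a₃ X Y S → a₁ * (X - S) + (a₂ * (X - Y) + a₃ * (S - Y))
                                   ≈ (a₂ + a₃) * (X - Y) + (a₁ - a₃) * (X - S)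
        regroup = solve 6 (λ a₁ a₂ a₃ X Y S → a₁ :* (X :- S) :+ (a₂ :* (X :- Y) :+ a₃ :* (S :- Y))
                                          := (a₂ :+ a₃) :* (X :- Y) :+ (a₁ :- a₃) :* (X :- S)) ≈-refl

    vanishes-off-points : ∀ {s} → All (λ y → ∣ y ∣ ≢ ∣ s ∣) points → EdgeCondition γ → EdgeCondition β →
                          ∀ w w' → IsProd F w α w' → ρ w (∣ app w s ∣) - ρ w' (∣ app w s ∣) ≈ 0#
    vanishes-off-points {s} (Pγ≢ ∷ Qγ≢ ∷ p₂≢ ∷ q₂≢ ∷ p₃≢ ∷ q₃≢ ∷ []) cond-γ cond-β w w' w'≡ws =
      Span₃-vanishes _ (decomposition cond-γ cond-β w w' w'≡ws)
        (off (P γ) (Q γ) Pγ≢ Qγ≢) (off p₂ q₂ p₂≢ q₂≢) (off p₃ q₃ p₃≢ q₃≢)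
      where
        off : ∀ a b → ∣ a ∣ ≢ ∣ s ∣ → ∣ b ∣ ≢ ∣ s ∣ → dx (app w a) (app w b) ∣ app w s ∣ ≈ 0#
        off a b a≢ b≢ = dx-off (app w a) (app w b) (app-∣∣-≢ w a s a≢) (app-∣∣-≢ w b s b≢)

  open Factorisation

  condition-from-factorisations : ∀ {α} (φ ψ : Factorisation α) → Adapted φ →
    EdgeCondition (γ φ) → EdgeCondition (β φ) → EdgeCondition (γ ψ) → EdgeCondition (β ψ) →
    All (λ y → ∣ y ∣ ≢ ∣ Q (γ φ) ∣) (points ψ) → EdgeCondition α
  condition-from-factorisations {α} φ ψ adapted cond-γφ cond-βφ cond-γψ cond-βψ
                                avoids@(_ ∷ _ ∷ p₂≢ ∷ q₂≢ ∷ _) w w' w'≡ws =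
    Span₂-collapse ∣ app w (Q (γ φ)) ∣ (adapted-span φ adapted cond-γφ cond-βφ w w' w'≡ws)
      (vanishes-off-points ψ {Q (γ φ)} avoids cond-γψ cond-βψ w w' w'≡ws)
      (dx-off (app w (P α)) (app w (Q α)) (app-∣∣-≢ w (P α) (Q (γ φ)) Pα≢) (app-∣∣-≢ w (Q α) (Q (γ φ)) Qα≢))
      (dx-∣∣ (app w (P α)) (app w (Q (γ φ))) (app-∣∣-≢ w (P α) (Q (γ φ)) Pα≢))
    where
      Pα≢ = proj₁ (Parallel-avoids (parallel ψ) p₂≢ q₂≢)
      Qα≢ = proj₂ (Parallel-avoids (parallel ψ) p₂≢ q₂≢)

-- Positive roots as nonnegative combinations of simple roots

sumℤ-cong : ∀ {n} {f g : Fin n → ℤ} → (∀ k → f k ≡ g k) → sumℤ f ≡ sumℤ g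
sumℤ-cong {zero}  f≗g = refl
sumℤ-cong {suc n} f≗g = cong₂ ℤ._+_ (f≗g Fin.zero) (sumℤ-cong (f≗g ∘ Fin.suc))

sumℤ-0 : ∀ n → sumℤ {n} (λ _ → + 0) ≡ + 0
sumℤ-0 zero    = refl
sumℤ-0 (suc n) = trans (ℤₚ.+-identityˡ _) (sumℤ-0 n)

sumℤ-+ : ∀ {n} (f g : Fin n → ℤ) → sumℤ (λ k → f k ℤ.+ g k) ≡ sumℤ f ℤ.+ sumℤ g
sumℤ-+ {zero}  f g = refl
sumℤ-+ {suc n} f g = begin
  (f₀ ℤ.+ g₀) ℤ.+ sumℤ (λ k → f (Fin.suc k) ℤ.+ g (Fin.suc k))
    ≡⟨ cong (λ x → (f₀ ℤ.+ g₀) ℤ.+ x) (sumℤ-+ (f ∘ Fin.suc) (g ∘ Fin.suc)) ⟩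
  (f₀ ℤ.+ g₀) ℤ.+ (sumℤ (f ∘ Fin.suc) ℤ.+ sumℤ (g ∘ Fin.suc))
    ≡⟨ interchange f₀ g₀ _ _ ⟩
  (f₀ ℤ.+ sumℤ (f ∘ Fin.suc)) ℤ.+ (g₀ ℤ.+ sumℤ (g ∘ Fin.suc))   ∎
  where
    open ≡-Reasoning
    f₀ = f Fin.zero
    g₀ = g Fin.zero
    interchange : ∀ a b c d → (a ℤ.+ b) ℤ.+ (c ℤ.+ d) ≡ (a ℤ.+ c) ℤ.+ (b ℤ.+ d)
    interchange = solve-∀

indicator : ∀ {n} → Fin n → Fin n → ℕ
indicator Fin.zero    Fin.zero    = 1
indicator Fin.zero    (Fin.suc _) = 0
indicator (Fin.suc _) Fin.zero    = 0
indicator (Fin.suc k) (Fin.suc l) = indicator k l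

sumℤ-indicator : ∀ {n} (k : Fin n) (f : Fin n → ℤ) → sumℤ (λ l → + indicator k l ℤ.* f l) ≡ f k
sumℤ-indicator {suc n} Fin.zero f = begin
  + 1 ℤ.* f Fin.zero ℤ.+ sumℤ {n} (λ _ → + 0) ≡⟨ cong₂ ℤ._+_ (ℤₚ.*-identityˡ (f Fin.zero)) (sumℤ-0 n) ⟩
  f Fin.zero ℤ.+ + 0                         ≡⟨ ℤₚ.+-identityʳ (f Fin.zero) ⟩
  f Fin.zero                                 ∎
  where open ≡-Reasoning
sumℤ-indicator (Fin.suc k) f = trans (ℤₚ.+-identityˡ _) (sumℤ-indicator k (f ∘ Fin.suc))

≡ᵇ-true : ∀ {a b} → (a ℕ.≡ᵇ b) ≡ true → a ≡ b
≡ᵇ-true {a} {b} eq = ℕₚ.≡ᵇ⇒≡ a b (subst T (sym eq) _)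

≡ᵇ-false : ∀ {a b} → (a ℕ.≡ᵇ b) ≡ false → a ≢ b
≡ᵇ-false {a} {b} eq a≡b = subst T eq (ℕₚ.≡⇒≡ᵇ a b a≡b)

last : ∀ {n} → Fin n → Σ (Fin n) λ l → suc (toℕ l) ≡ n
last {suc n} _ = Fin.fromℕ n , cong suc (Finₚ.toℕ-fromℕ n)

module _ {n : ℕ} where

  adjacent⇒< : {i s : Fin n} → toℕ s ≡ suc (toℕ i) → i Fin.< s
  adjacent⇒< s≡1+i = ℕₚ.≤-reflexive (sym s≡1+i)

  simple-minus : ∀ t (k l : Fin n) (k<l : k Fin.< l) → toℕ l ≡ suc (toℕ k) →
                 ∀ m → simpleVec t k m ≡ vec t (minus k l k<l) m
  simple-minus B k l k<l l≡1+k m with k Fin.≟ m | l Fin.≟ m | toℕ m ℕ.≡ᵇ suc (toℕ k) in m≟1+k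
  ... | yes refl | yes refl | _     = ⊥-elim (ℕₚ.<-irrefl refl k<l)
  ... | yes refl | no _     | _     = refl
  ... | no _     | yes refl | true  = refl
  ... | no _     | yes refl | false = ⊥-elim (≡ᵇ-false m≟1+k l≡1+k)
  ... | no _     | no l≢m  | true  = ⊥-elim (l≢m (Finₚ.toℕ-injective (trans l≡1+k (sym (≡ᵇ-true m≟1+k)))))
  ... | no _     | no _     | false = refl
  simple-minus C k l k<l l≡1+k m
    with k Fin.≟ m | l Fin.≟ m | toℕ m ℕ.≡ᵇ suc (toℕ k) in m≟1+k | suc (toℕ k) ℕ.≡ᵇ n in 1+k≟n
  ... | yes refl | yes refl | _     | _     = ⊥-elim (ℕₚ.<-irrefl refl k<l)
  ... | yes refl | no _     | _     | true  =
    ⊥-elim (ℕₚ.<-irrefl (trans l≡1+k (≡ᵇ-true 1+k≟n)) (Finₚ.toℕ<n l))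
  ... | yes refl | no _     | _     | false = refl
  ... | no _     | yes refl | true  | _     = refl
  ... | no _     | yes refl | false | _     = ⊥-elim (≡ᵇ-false m≟1+k l≡1+k)
  ... | no _     | no l≢m  | true  | _     =
    ⊥-elim (l≢m (Finₚ.toℕ-injective (trans l≡1+k (sym (≡ᵇ-true m≟1+k)))))
  ... | no _     | no _     | false | _     = refl

  simple-unit : ∀ t (k : Fin n) → suc (toℕ k) ≡ n → ∀ m → simpleVec t k m ≡ vec t (unit k) m
  simple-unit B k 1+k≡n m with k Fin.≟ m | toℕ m ℕ.≡ᵇ suc (toℕ k) in m≟1+k
  ... | yes _ | _     = refl
  ... | no _  | true  = ⊥-elim (ℕₚ.<-irrefl (trans (≡ᵇ-true m≟1+k) 1+k≡n) (Finₚ.toℕ<n m))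
  ... | no _  | false = refl
  simple-unit C k 1+k≡n m with k Fin.≟ m | toℕ m ℕ.≡ᵇ suc (toℕ k) in m≟1+k | suc (toℕ k) ℕ.≡ᵇ n in 1+k≟n
  ... | yes _ | _     | true  = refl
  ... | yes _ | _     | false = ⊥-elim (≡ᵇ-false 1+k≟n 1+k≡n)
  ... | no _  | true  | _     = ⊥-elim (ℕₚ.<-irrefl (trans (≡ᵇ-true m≟1+k) 1+k≡n) (Finₚ.toℕ<n m))
  ... | no _  | false | _     = refl

  minus-simple : ∀ t (i j : Fin n) (i<j : i Fin.< j) → toℕ j ≡ suc (toℕ i) → IsSimple t (minus i j i<j)
  minus-simple t i j i<j j≡1+i = i , λ m → sym (simple-minus t i j i<j j≡1+i m)

  unit-simple : ∀ t (i : Fin n) → suc (toℕ i) ≡ n → IsSimple t (unit i)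
  unit-simple t i 1+i≡n = i , λ m → sym (simple-unit t i 1+i≡n m)

  record Combination (t : RootType) (v : Fin n → ℤ) : Set where
    constructor _,_
    field
      coefficient : Fin n → ℕ
      expansion   : ∀ m → v m ≡ sumℤ (λ k → + coefficient k ℤ.* simpleVec t k m)

  ≼-by : ∀ {t} α β {v} → Combination t v → (∀ m → vec t β m ≡ vec t α m ℤ.+ v m) → α ≼[ t ] β
  ≼-by {t} α β (c , v≡) β≡α+v = c , λ m → trans (β≡α+v m) (cong (λ x → vec t α m ℤ.+ x) (v≡ m))

  combination-zero : ∀ {t v} → (∀ m → v m ≡ + 0) → Combination t v
  combination-zero {t} v≡0 = (λ _ → 0) , λ m → trans (v≡0 m) (sym (sumℤ-0 n))

  combination-+ : ∀ {t u v} → Combination t u → Combination t v → Combination t (λ m → u m ℤ.+ v m)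
  combination-+ {t} (c , u≡) (d , v≡) = (λ k → c k ℕ.+ d k) , λ m → begin
    _ ≡⟨ cong₂ ℤ._+_ (u≡ m) (v≡ m) ⟩
    sumℤ (λ k → + c k ℤ.* simpleVec t k m) ℤ.+ sumℤ (λ k → + d k ℤ.* simpleVec t k m)
      ≡⟨ sumℤ-+ (λ k → + c k ℤ.* simpleVec t k m) (λ k → + d k ℤ.* simpleVec t k m) ⟨
    sumℤ (λ k → + c k ℤ.* simpleVec t k m ℤ.+ + d k ℤ.* simpleVec t k m)
      ≡⟨ sumℤ-cong (λ k → ℤₚ.*-distribʳ-+ (simpleVec t k m) (+ c k) (+ d k)) ⟨
    sumℤ (λ k → + (c k ℕ.+ d k) ℤ.* simpleVec t k m) ∎
    where open ≡-Reasoning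

  combination-simple : ∀ t k → Combination t (simpleVec t k)
  combination-simple t k = indicator k , λ m → sym (sumℤ-indicator k (λ l → simpleVec t l m))

  combination-≗ : ∀ {t u v} → (∀ m → u m ≡ v m) → Combination t u → Combination t v
  combination-≗ u≗v (c , u≡) = c , λ m → trans (sym (u≗v m)) (u≡ m)

  combination-δ-δ : ∀ t (i j : Fin n) → toℕ i ℕ.≤ toℕ j → Combination t (λ m → δ i m ℤ.- δ j m)
  combination-δ-δ t i j i≤j = go (toℕ j ℕ.∸ toℕ i) j (sym (ℕₚ.m+[n∸m]≡n i≤j))
    where
      go : ∀ d (j : Fin n) → toℕ j ≡ toℕ i ℕ.+ d → Combination t (λ m → δ i m ℤ.- δ j m)
      go zero j j≡i+0 with Finₚ.toℕ-injective (trans j≡i+0 (ℕₚ.+-identityʳ (toℕ i)))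
      ... | refl = combination-zero (λ m → ℤₚ.+-inverseʳ (δ i m))
      go (suc d) j j≡i+1+d =
        combination-≗ (λ m → split (δ i m) (δ j' m) (δ j m))
          (combination-+ (go d j' j'≡i+d)
            (combination-≗ (simple-minus t j' j j'<j j≡1+j') (combination-simple t j')))
        where
          j≡1+i+d : toℕ j ≡ suc (toℕ i ℕ.+ d)
          j≡1+i+d = trans j≡i+1+d (ℕₚ.+-suc (toℕ i) d)
          i+d<n : toℕ i ℕ.+ d ℕ.< n
          i+d<n = ℕₚ.<-trans (ℕₚ.n<1+n _) (subst (ℕ._< n) j≡1+i+d (Finₚ.toℕ<n j))
          j' = Fin.fromℕ< i+d<n
          j'≡i+d : toℕ j' ≡ toℕ i ℕ.+ d
          j'≡i+d = Finₚ.toℕ-fromℕ< i+d<n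
          j≡1+j' : toℕ j ≡ suc (toℕ j')
          j≡1+j' = trans j≡1+i+d (cong suc (sym j'≡i+d))
          j'<j : j' Fin.< j
          j'<j = ℕₚ.≤-reflexive (sym j≡1+j')
          split : ∀ a b c → (a ℤ.- b) ℤ.+ (b ℤ.- c) ≡ a ℤ.- c
          split = solve-∀

  combination-unit : ∀ t (i : Fin n) → Combination t (vec t (unit i))
  combination-unit t i = by-type t
    where
      l = proj₁ (last i)
      1+l≡n = proj₂ (last i)
      i≤l : toℕ i ℕ.≤ toℕ l
      i≤l = ℕₚ.≤-pred (subst (toℕ i ℕ.<_) (sym 1+l≡n) (Finₚ.toℕ<n i))
      unit-l : ∀ t → Combination t (vec t (unit l))
      unit-l t = combination-≗ (simple-unit t l 1+l≡n) (combination-simple t l)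
      by-type : ∀ t → Combination t (vec t (unit i))
      by-type B = combination-≗ (λ m → split (δ i m) (δ l m))
                    (combination-+ (combination-δ-δ B i l i≤l) (unit-l B))
        where split : ∀ a b → (a ℤ.- b) ℤ.+ b ≡ a
              split = solve-∀
      by-type C = combination-≗ (λ m → split (δ i m) (δ l m))
                    (combination-+ (combination-δ-δ C i l i≤l)
                                   (combination-+ (combination-δ-δ C i l i≤l) (unit-l C)))
        where split : ∀ a b → (a ℤ.- b) ℤ.+ ((a ℤ.- b) ℤ.+ + 2 ℤ.* b) ≡ + 2 ℤ.* a
              split = solve-∀

  minus-≼-minus : ∀ t {i i' j j' : Fin n} (i'<j' : i' Fin.< j') (i<j : i Fin.< j) →
                  toℕ i ℕ.≤ toℕ i' → toℕ j' ℕ.≤ toℕ j → minus i' j' i'<j' ≼[ t ] minus i j i<j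
  minus-≼-minus t {i} {i'} {j} {j'} i'<j' i<j i≤i' j'≤j =
    ≼-by (minus i' j' i'<j') (minus i j i<j)
         (combination-+ (combination-δ-δ t i i' i≤i') (combination-δ-δ t j' j j'≤j))
         (λ m → split (δ i m) (δ i' m) (δ j m) (δ j' m))
    where split : ∀ a a' b b' → a ℤ.- b ≡ (a' ℤ.- b') ℤ.+ ((a ℤ.- a') ℤ.+ (b' ℤ.- b))
          split = solve-∀

  plus-≼-plus : ∀ t {i i' j j' : Fin n} (i'<j' : i' Fin.< j') (i<j : i Fin.< j) →
                toℕ i ℕ.≤ toℕ i' → toℕ j ℕ.≤ toℕ j' → plus i' j' i'<j' ≼[ t ] plus i j i<j
  plus-≼-plus t {i} {i'} {j} {j'} i'<j' i<j i≤i' j≤j' =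
    ≼-by (plus i' j' i'<j') (plus i j i<j)
         (combination-+ (combination-δ-δ t i i' i≤i') (combination-δ-δ t j j' j≤j'))
         (λ m → split (δ i m) (δ i' m) (δ j m) (δ j' m))
    where split : ∀ a a' b b' → a ℤ.+ b ≡ (a' ℤ.+ b') ℤ.+ ((a ℤ.- a') ℤ.+ (b ℤ.- b'))
          split = solve-∀

  unit-≼-unit : ∀ t {i s : Fin n} → toℕ i ℕ.≤ toℕ s → unit s ≼[ t ] unit i
  unit-≼-unit B {i} {s} i≤s = ≼-by (unit s) (unit i) (combination-δ-δ B i s i≤s) (λ m → split (δ i m) (δ s m))
    where split : ∀ a b → a ≡ b ℤ.+ (a ℤ.- b)
          split = solve-∀
  unit-≼-unit C {i} {s} i≤s =
    ≼-by (unit s) (unit i) (combination-+ (combination-δ-δ C i s i≤s) (combination-δ-δ C i s i≤s))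
         (λ m → split (δ i m) (δ s m))
    where split : ∀ a b → + 2 ℤ.* a ≡ + 2 ℤ.* b ℤ.+ ((a ℤ.- b) ℤ.+ (a ℤ.- b))
          split = solve-∀

  minus≼unit : ∀ t (i j : Fin n) (i<j : i Fin.< j) → minus i j i<j ≼[ t ] unit i
  minus≼unit B i j i<j = ≼-by (minus i j i<j) (unit i) (combination-unit B j) (λ m → split (δ i m) (δ j m))
    where split : ∀ a b → a ≡ (a ℤ.- b) ℤ.+ b
          split = solve-∀
  minus≼unit C i j i<j =
    ≼-by (minus i j i<j) (unit i) (combination-+ (combination-δ-δ C i j (ℕₚ.<⇒≤ i<j)) (combination-unit C j))
         (λ m → split (δ i m) (δ j m))
    where split : ∀ a b → + 2 ℤ.* a ≡ (a ℤ.- b) ℤ.+ ((a ℤ.- b) ℤ.+ + 2 ℤ.* b)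
          split = solve-∀

  unit≼plus : ∀ t (i j : Fin n) (i<j : i Fin.< j) → unit j ≼[ t ] plus i j i<j
  unit≼plus B i j i<j = ≼-by (unit j) (plus i j i<j) (combination-unit B i) (λ m → split (δ i m) (δ j m))
    where split : ∀ a b → a ℤ.+ b ≡ b ℤ.+ a
          split = solve-∀
  unit≼plus C i j i<j =
    ≼-by (unit j) (plus i j i<j) (combination-δ-δ C i j (ℕₚ.<⇒≤ i<j)) (λ m → split (δ i m) (δ j m))
    where split : ∀ a b → a ℤ.+ b ≡ + 2 ℤ.* b ℤ.+ (a ℤ.- b)
          split = solve-∀

  minus≼plus : ∀ t (i j : Fin n) (i<j : i Fin.< j) → minus i j i<j ≼[ t ] plus i j i<j
  minus≼plus B i j i<j =
    ≼-by (minus i j i<j) (plus i j i<j) (combination-+ (combination-unit B j) (combination-unit B j))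
         (λ m → split (δ i m) (δ j m))
    where split : ∀ a b → a ℤ.+ b ≡ (a ℤ.- b) ℤ.+ (b ℤ.+ b)
          split = solve-∀
  minus≼plus C i j i<j =
    ≼-by (minus i j i<j) (plus i j i<j) (combination-unit C j) (λ m → split (δ i m) (δ j m))
    where split : ∀ a b → a ℤ.+ b ≡ (a ℤ.- b) ℤ.+ + 2 ℤ.* b
          split = solve-∀

-- Simple roots and reflections of simple roots

δ≡indicator : ∀ {n} (a k : Fin n) → δ a k ≡ + indicator a k
δ≡indicator Fin.zero    Fin.zero    = refl
δ≡indicator Fin.zero    (Fin.suc k) = refl
δ≡indicator (Fin.suc a) Fin.zero    = refl
δ≡indicator (Fin.suc a) (Fin.suc k) = δ≡indicator a k

sumℤ-δ : ∀ {n} (a : Fin n) → sumℤ (δ a) ≡ + 1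
sumℤ-δ a = begin
  sumℤ (δ a)
    ≡⟨ sumℤ-cong (λ k → trans (δ≡indicator a k) (sym (ℤₚ.*-identityʳ _))) ⟩
  sumℤ (λ k → + indicator a k ℤ.* + 1)    ≡⟨ sumℤ-indicator a (λ _ → + 1) ⟩
  + 1                                     ∎
  where open ≡-Reasoning

sumℤ-scale : ∀ {n} x (f : Fin n → ℤ) → sumℤ (λ k → x ℤ.* f k) ≡ x ℤ.* sumℤ f
sumℤ-scale {zero}  x f = sym (ℤₚ.*-zeroʳ x)
sumℤ-scale {suc n} x f =
  trans (cong (λ s → x ℤ.* f Fin.zero ℤ.+ s) (sumℤ-scale x (f ∘ Fin.suc))) (sym (ℤₚ.*-distribˡ-+ x _ _))

dot-by : ∀ {n} (u v : Fin n → ℤ) x y (a b : Fin n) →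
         (∀ k → u k ℤ.* v k ≡ x ℤ.* δ a k ℤ.+ y ℤ.* δ b k) → dot u v ≡ x ℤ.+ y
dot-by u v x y a b uv≡ = begin
  sumℤ (λ k → u k ℤ.* v k)                             ≡⟨ sumℤ-cong uv≡ ⟩
  sumℤ (λ k → x ℤ.* δ a k ℤ.+ y ℤ.* δ b k)             ≡⟨ sumℤ-+ (λ k → x ℤ.* δ a k) (λ k → y ℤ.* δ b k) ⟩
  sumℤ (λ k → x ℤ.* δ a k) ℤ.+ sumℤ (λ k → y ℤ.* δ b k) ≡⟨ cong₂ ℤ._+_ (sumℤ-scale x (δ a)) (sumℤ-scale y (δ b)) ⟩
  x ℤ.* sumℤ (δ a) ℤ.+ y ℤ.* sumℤ (δ b)                 ≡⟨ cong₂ (λ s t → x ℤ.* s ℤ.+ y ℤ.* t) (sumℤ-δ a) (sumℤ-δ b) ⟩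
  x ℤ.* + 1 ℤ.+ y ℤ.* + 1                               ≡⟨ cong₂ ℤ._+_ (ℤₚ.*-identityʳ x) (ℤₚ.*-identityʳ y) ⟩
  x ℤ.+ y                                               ∎
  where open ≡-Reasoning

module _ {n : ℕ} where

  δ-cases₂ : (R : ℤ → ℤ → Set) {a b : Fin n} → a ≢ b → R (+ 1) (+ 0) → R (+ 0) (+ 1) → R (+ 0) (+ 0) →
             ∀ k → R (δ a k) (δ b k)
  δ-cases₂ R {a} {b} a≢b r₁₀ r₀₁ r₀₀ k with a Fin.≟ k | b Fin.≟ k
  ... | yes refl | yes refl = ⊥-elim (a≢b refl)
  ... | yes _    | no _     = r₁₀
  ... | no _     | yes _    = r₀₁
  ... | no _     | no _     = r₀₀

  δ-cases₃ : (R : ℤ → ℤ → ℤ → Set) {a b c : Fin n} → a ≢ b → b ≢ c → a ≢ c →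
             R (+ 1) (+ 0) (+ 0) → R (+ 0) (+ 1) (+ 0) → R (+ 0) (+ 0) (+ 1) → R (+ 0) (+ 0) (+ 0) →
             ∀ k → R (δ a k) (δ b k) (δ c k)
  δ-cases₃ R {a} {b} {c} a≢b b≢c a≢c r₁ r₂ r₃ r₀ k with a Fin.≟ k | b Fin.≟ k | c Fin.≟ k
  ... | yes refl | yes refl | _        = ⊥-elim (a≢b refl)
  ... | _        | yes refl | yes refl = ⊥-elim (b≢c refl)
  ... | yes refl | _        | yes refl = ⊥-elim (a≢c refl)
  ... | yes _    | no _     | no _     = r₁
  ... | no _     | yes _    | no _     = r₂
  ... | no _     | no _     | yes _    = r₃
  ... | no _     | no _     | no _     = r₀

  dot-adjacent : ∀ t (i s : Fin n) → toℕ s ≡ suc (toℕ i) → dot (simpleVec t i) (simpleVec t i) ≡ + 1 ℤ.+ + 1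
  dot-adjacent t i s s≡1+i = dot-by (simpleVec t i) (simpleVec t i) (+ 1) (+ 1) i s λ k →
    trans (cong₂ ℤ._*_ (αᵢ k) (αᵢ k))
          (δ-cases₂ (λ x y → (x ℤ.- y) ℤ.* (x ℤ.- y) ≡ + 1 ℤ.* x ℤ.+ + 1 ℤ.* y) (Finₚ.<⇒≢ i<s) refl refl refl k)
    where
      i<s = adjacent⇒< s≡1+i
      αᵢ = simple-minus t i s i<s s≡1+i

  reflection-minus : ∀ t (i s j : Fin n) (i<j : i Fin.< j) → toℕ s ≡ suc (toℕ i) → toℕ j ≡ suc (toℕ s) →
                     IsSimpleReflOfSimple t (minus i j i<j)
  reflection-minus t i s j i<j s≡1+i j≡1+s = i , s , Finₚ.<⇒≢ i<s , ℤ.- + 1 , coefficient , vector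
    where
      i<s = adjacent⇒< s≡1+i
      s<j = adjacent⇒< j≡1+s
      αᵢ = simple-minus t i s i<s s≡1+i
      αₛ = simple-minus t s j s<j j≡1+s
      αₛ·αᵢ : dot (simpleVec t s) (simpleVec t i) ≡ ℤ.- + 1 ℤ.+ + 0
      αₛ·αᵢ = dot-by (simpleVec t s) (simpleVec t i) (ℤ.- + 1) (+ 0) s i λ k →
        trans (cong₂ ℤ._*_ (αₛ k) (αᵢ k))
              (δ-cases₃ (λ x y z → (y ℤ.- z) ℤ.* (x ℤ.- y) ≡ ℤ.- + 1 ℤ.* y ℤ.+ + 0 ℤ.* x)
                        (Finₚ.<⇒≢ i<s) (Finₚ.<⇒≢ s<j) (Finₚ.<⇒≢ i<j) refl refl refl refl k)
      coefficient : ℤ.- + 1 ℤ.* dot (simpleVec t i) (simpleVec t i)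
                  ≡ + 2 ℤ.* dot (simpleVec t s) (simpleVec t i)
      coefficient rewrite dot-adjacent t i s s≡1+i | αₛ·αᵢ = refl
      vector : ∀ m → δ i m ℤ.- δ j m ≡ simpleVec t s m ℤ.- ℤ.- + 1 ℤ.* simpleVec t i m
      vector m rewrite αᵢ m | αₛ m = split (δ i m) (δ s m) (δ j m)
        where split : ∀ a b c → a ℤ.- c ≡ (b ℤ.- c) ℤ.- ℤ.- + 1 ℤ.* (a ℤ.- b)
              split = solve-∀

  reflection-unit : ∀ t (i l : Fin n) → toℕ l ≡ suc (toℕ i) → suc (toℕ l) ≡ n → IsSimpleReflOfSimple t (unit i)
  reflection-unit B i l l≡1+i 1+l≡n = i , l , i≢l , ℤ.- + 1 , coefficient , vector
    where
      αᵢ = simple-minus B i l (adjacent⇒< l≡1+i) l≡1+i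
      αₗ = simple-unit B l 1+l≡n
      i≢l = Finₚ.<⇒≢ (adjacent⇒< l≡1+i)
      l≢i = i≢l ∘ sym
      αₗ·αᵢ : dot (simpleVec B l) (simpleVec B i) ≡ ℤ.- + 1 ℤ.+ + 0
      αₗ·αᵢ = dot-by (simpleVec B l) (simpleVec B i) (ℤ.- + 1) (+ 0) l i λ k →
        trans (cong₂ ℤ._*_ (αₗ k) (αᵢ k))
              (δ-cases₂ (λ y z → y ℤ.* (z ℤ.- y) ≡ ℤ.- + 1 ℤ.* y ℤ.+ + 0 ℤ.* z) l≢i refl refl refl k)
      coefficient : ℤ.- + 1 ℤ.* dot (simpleVec B i) (simpleVec B i)
                  ≡ + 2 ℤ.* dot (simpleVec B l) (simpleVec B i)
      coefficient rewrite dot-adjacent B i l l≡1+i | αₗ·αᵢ = refl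
      vector : ∀ m → δ i m ≡ simpleVec B l m ℤ.- ℤ.- + 1 ℤ.* simpleVec B i m
      vector m rewrite αᵢ m | αₗ m = split (δ i m) (δ l m)
        where split : ∀ a b → a ≡ b ℤ.- ℤ.- + 1 ℤ.* (a ℤ.- b)
              split = solve-∀
  reflection-unit C i l l≡1+i 1+l≡n = i , l , i≢l , ℤ.- + 2 , coefficient , vector
    where
      αᵢ = simple-minus C i l (adjacent⇒< l≡1+i) l≡1+i
      αₗ = simple-unit C l 1+l≡n
      i≢l = Finₚ.<⇒≢ (adjacent⇒< l≡1+i)
      l≢i = i≢l ∘ sym
      αₗ·αᵢ : dot (simpleVec C l) (simpleVec C i) ≡ ℤ.- + 2 ℤ.+ + 0
      αₗ·αᵢ = dot-by (simpleVec C l) (simpleVec C i) (ℤ.- + 2) (+ 0) l i λ k →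
        trans (cong₂ ℤ._*_ (αₗ k) (αᵢ k))
              (δ-cases₂ (λ y z → (+ 2 ℤ.* y) ℤ.* (z ℤ.- y) ≡ ℤ.- + 2 ℤ.* y ℤ.+ + 0 ℤ.* z) l≢i refl refl refl k)
      coefficient : ℤ.- + 2 ℤ.* dot (simpleVec C i) (simpleVec C i)
                  ≡ + 2 ℤ.* dot (simpleVec C l) (simpleVec C i)
      coefficient rewrite dot-adjacent C i l l≡1+i | αₗ·αᵢ = refl
      vector : ∀ m → + 2 ℤ.* δ i m ≡ simpleVec C l m ℤ.- ℤ.- + 2 ℤ.* simpleVec C i m
      vector m rewrite αᵢ m | αₗ m = split (δ i m) (δ l m)
        where split : ∀ a b → + 2 ℤ.* a ≡ + 2 ℤ.* b ℤ.- ℤ.- + 2 ℤ.* (a ℤ.- b)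
              split = solve-∀

  reflection-plus : ∀ t (i j : Fin n) (i<j : i Fin.< j) → toℕ j ≡ suc (toℕ i) → suc (toℕ j) ≡ n →
                    IsSimpleReflOfSimple t (plus i j i<j)
  reflection-plus B i j i<j j≡1+i 1+j≡n = j , i , j≢i , ℤ.- + 2 , coefficient , vector
    where
      αᵢ = simple-minus B i j i<j j≡1+i
      αⱼ = simple-unit B j 1+j≡n
      j≢i = Finₚ.<⇒≢ i<j ∘ sym
      αⱼ·αⱼ : dot (simpleVec B j) (simpleVec B j) ≡ + 1 ℤ.+ + 0
      αⱼ·αⱼ = dot-by (simpleVec B j) (simpleVec B j) (+ 1) (+ 0) j i λ k →
        trans (cong₂ ℤ._*_ (αⱼ k) (αⱼ k))
              (δ-cases₂ (λ y z → y ℤ.* y ≡ + 1 ℤ.* y ℤ.+ + 0 ℤ.* z) j≢i refl refl refl k)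
      αᵢ·αⱼ : dot (simpleVec B i) (simpleVec B j) ≡ ℤ.- + 1 ℤ.+ + 0
      αᵢ·αⱼ = dot-by (simpleVec B i) (simpleVec B j) (ℤ.- + 1) (+ 0) j i λ k →
        trans (cong₂ ℤ._*_ (αᵢ k) (αⱼ k))
              (δ-cases₂ (λ y z → (z ℤ.- y) ℤ.* y ≡ ℤ.- + 1 ℤ.* y ℤ.+ + 0 ℤ.* z) j≢i refl refl refl k)
      coefficient : ℤ.- + 2 ℤ.* dot (simpleVec B j) (simpleVec B j)
                  ≡ + 2 ℤ.* dot (simpleVec B i) (simpleVec B j)
      coefficient rewrite αⱼ·αⱼ | αᵢ·αⱼ = refl
      vector : ∀ m → δ i m ℤ.+ δ j m ≡ simpleVec B i m ℤ.- ℤ.- + 2 ℤ.* simpleVec B j m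
      vector m rewrite αᵢ m | αⱼ m = split (δ i m) (δ j m)
        where split : ∀ a b → a ℤ.+ b ≡ (a ℤ.- b) ℤ.- ℤ.- + 2 ℤ.* b
              split = solve-∀
  reflection-plus C i j i<j j≡1+i 1+j≡n = j , i , j≢i , ℤ.- + 1 , coefficient , vector
    where
      αᵢ = simple-minus C i j i<j j≡1+i
      αⱼ = simple-unit C j 1+j≡n
      j≢i = Finₚ.<⇒≢ i<j ∘ sym
      αⱼ·αⱼ : dot (simpleVec C j) (simpleVec C j) ≡ + 4 ℤ.+ + 0
      αⱼ·αⱼ = dot-by (simpleVec C j) (simpleVec C j) (+ 4) (+ 0) j i λ k →
        trans (cong₂ ℤ._*_ (αⱼ k) (αⱼ k))
              (δ-cases₂ (λ y z → (+ 2 ℤ.* y) ℤ.* (+ 2 ℤ.* y) ≡ + 4 ℤ.* y ℤ.+ + 0 ℤ.* z) j≢i refl refl refl k)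
      αᵢ·αⱼ : dot (simpleVec C i) (simpleVec C j) ≡ ℤ.- + 2 ℤ.+ + 0
      αᵢ·αⱼ = dot-by (simpleVec C i) (simpleVec C j) (ℤ.- + 2) (+ 0) j i λ k →
        trans (cong₂ ℤ._*_ (αᵢ k) (αⱼ k))
              (δ-cases₂ (λ y z → (z ℤ.- y) ℤ.* (+ 2 ℤ.* y) ≡ ℤ.- + 2 ℤ.* y ℤ.+ + 0 ℤ.* z) j≢i refl refl refl k)
      coefficient : ℤ.- + 1 ℤ.* dot (simpleVec C j) (simpleVec C j)
                  ≡ + 2 ℤ.* dot (simpleVec C i) (simpleVec C j)
      coefficient rewrite αⱼ·αⱼ | αᵢ·αⱼ = refl
      vector : ∀ m → δ i m ℤ.+ δ j m ≡ simpleVec C i m ℤ.- ℤ.- + 1 ℤ.* simpleVec C j m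
      vector m rewrite αᵢ m | αⱼ m = split (δ i m) (δ j m)
        where split : ∀ a b → a ℤ.+ b ≡ (a ℤ.- b) ℤ.- ℤ.- + 1 ℤ.* (+ 2 ℤ.* b)
              split = solve-∀

-- The factorisations of reflections used in the induction

module _ {n : ℕ} where

  open Transposition

  pos≢pos : {a b : Fin n} → a ≢ b → pos a ≢ pos b
  pos≢pos a≢b = a≢b ∘ cong proj₂

  neg≢neg : {a b : Fin n} → a ≢ b → neg a ≢ neg b
  neg≢neg a≢b = a≢b ∘ cong proj₂

  pos≢neg : {a b : Fin n} → pos a ≢ neg b
  pos≢neg ()

  neg≢pos : {a b : Fin n} → neg a ≢ pos b
  neg≢pos ()

  <⇒≢ : {a b : Fin n} → a Fin.< b → a ≢ b
  <⇒≢ = Finₚ.<⇒≢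

  >⇒≢ : {a b : Fin n} → b Fin.< a → a ≢ b
  >⇒≢ b<a = Finₚ.<⇒≢ b<a ∘ sym

  minus-factorisation : (i s j : Fin n) (i<s : i Fin.< s) (s<j : s Fin.< j) (i<j : i Fin.< j) →
                        Factorisation (minus i j i<j)
  minus-factorisation i s j i<s s<j i<j = record
    { γ = minus i s i<s ; β = minus s j s<j
    ; p₂ = pos i ; q₂ = pos j ; p₃ = pos s ; q₃ = pos j
    ; γ-P-β = transp-q (pos i) (pos s) i≢s
    ; γ-Q-β = σj≡j
    ; γβ-P-γ = trans (cong σ (transp-other (pos s) (pos j) s≢j (pos i)
                                 (pos≢pos (<⇒≢ i<s)) (pos≢pos (<⇒≢ i<j)) pos≢neg pos≢neg))
                     (transp-p (pos i) (pos s) i≢s)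
    ; γβ-Q-γ = trans (cong σ (transp-p (pos s) (pos j) s≢j)) σj≡j
    ; parallel = same
    }
    where
      i≢s = pos≢pos (<⇒≢ i<s)
      s≢j = pos≢pos (<⇒≢ s<j)
      σ = transp (pos i) (pos s)
      σj≡j : σ (pos j) ≡ pos j
      σj≡j = transp-other (pos i) (pos s) i≢s (pos j) (pos≢pos (>⇒≢ i<j)) (pos≢pos (>⇒≢ s<j)) pos≢neg pos≢neg

  unit-factorisation : (i s : Fin n) (i<s : i Fin.< s) → Factorisation (unit i)
  unit-factorisation i s i<s = record
    { γ = minus i s i<s ; β = unit s
    ; p₂ = pos i ; q₂ = neg i ; p₃ = pos s ; q₃ = neg i
    ; γ-P-β = transp-q (pos i) (pos s) i≢s
    ; γ-Q-β = transp-bar-q (pos i) (pos s) i≢s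
    ; γβ-P-γ = trans (cong σ (transp-other (pos s) (neg s) pos≢neg (pos i) (i≢s) pos≢neg pos≢neg i≢s))
                     (transp-p (pos i) (pos s) i≢s)
    ; γβ-Q-γ = trans (cong σ (transp-p (pos s) (neg s) pos≢neg)) (transp-bar-q (pos i) (pos s) i≢s)
    ; parallel = same
    }
    where
      i≢s = pos≢pos (<⇒≢ i<s)
      σ = transp (pos i) (pos s)

  plus-factorisation-above : (i j s : Fin n) (i<j : i Fin.< j) (j<s : j Fin.< s) (i<s : i Fin.< s) →
                             Factorisation (plus i j i<j)
  plus-factorisation-above i j s i<j j<s i<s = record
    { γ = plus i s i<s ; β = minus j s j<s
    ; p₂ = pos j ; q₂ = neg i ; p₃ = neg s ; q₃ = neg j
    ; γ-P-β = transp-other (pos i) (neg s) pos≢neg (pos j)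
                (pos≢pos (>⇒≢ i<j)) pos≢neg pos≢neg (pos≢pos (<⇒≢ j<s))
    ; γ-Q-β = transp-bar-q (pos i) (neg s) pos≢neg
    ; γβ-P-γ = trans (cong σ (transp-other (pos j) (pos s) j≢s (pos i)
                                 (pos≢pos (<⇒≢ i<j)) (pos≢pos (<⇒≢ i<s)) pos≢neg pos≢neg))
                     (transp-p (pos i) (neg s) pos≢neg)
    ; γβ-Q-γ = trans (cong σ (transp-bar-q (pos j) (pos s) j≢s))
                     (transp-other (pos i) (neg s) pos≢neg (neg j)
                        neg≢pos (neg≢neg (<⇒≢ j<s)) (neg≢neg (>⇒≢ i<j)) neg≢pos)
    ; parallel = reversed
    }
    where
      j≢s = pos≢pos (<⇒≢ j<s)
      σ = transp (pos i) (neg s)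

  plus-factorisation-unit : (i j : Fin n) (i<j : i Fin.< j) → Factorisation (plus i j i<j)
  plus-factorisation-unit i j i<j = record
    { γ = unit j ; β = minus i j i<j
    ; p₂ = pos i ; q₂ = neg j ; p₃ = pos i ; q₃ = neg i
    ; γ-P-β = σi≡i
    ; γ-Q-β = transp-p (pos j) (neg j) pos≢neg
    ; γβ-P-γ = trans (cong σ (transp-q (pos i) (pos j) i≢j)) σi≡i
    ; γβ-Q-γ = trans (cong σ (transp-bar-q (pos i) (pos j) i≢j))
                     (transp-other (pos j) (neg j) pos≢neg (neg i)
                        neg≢pos (neg≢neg (<⇒≢ i<j)) (neg≢neg (<⇒≢ i<j)) neg≢pos)
    ; parallel = same
    }
    where
      i≢j = pos≢pos (<⇒≢ i<j)
      σ = transp (pos j) (neg j)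
      σi≡i : σ (pos i) ≡ pos i
      σi≡i = transp-other (pos j) (neg j) pos≢neg (pos i) i≢j pos≢neg pos≢neg i≢j

  plus-factorisation-below : (i s j : Fin n) (i<s : i Fin.< s) (s<j : s Fin.< j) (i<j : i Fin.< j) →
                             Factorisation (plus i j i<j)
  plus-factorisation-below i s j i<s s<j i<j = record
    { γ = minus i s i<s ; β = plus s j s<j
    ; p₂ = pos i ; q₂ = neg j ; p₃ = pos s ; q₃ = neg j
    ; γ-P-β = transp-q (pos i) (pos s) i≢s
    ; γ-Q-β = σj̄≡j̄
    ; γβ-P-γ = trans (cong σ (transp-other (pos s) (neg j) pos≢neg (pos i)
                                 i≢s pos≢neg pos≢neg (pos≢pos (<⇒≢ i<j))))
                     (transp-p (pos i) (pos s) i≢s)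
    ; γβ-Q-γ = trans (cong σ (transp-p (pos s) (neg j) pos≢neg)) σj̄≡j̄
    ; parallel = same
    }
    where
      i≢s = pos≢pos (<⇒≢ i<s)
      σ = transp (pos i) (pos s)
      σj̄≡j̄ : σ (neg j) ≡ neg j
      σj̄≡j̄ = transp-other (pos i) (pos s) i≢s (neg j) neg≢pos neg≢pos (neg≢neg (>⇒≢ i<j)) (neg≢neg (>⇒≢ s<j))

-- Induction on the rank

module _ {n : ℕ} where

  rank : PosRoot n → ℕ
  rank (minus i j _) = toℕ j ∸ toℕ i
  rank (unit i)      = n ℕ.+ (n ∸ toℕ i)
  rank (plus i j _)  = (n ℕ.+ n) ℕ.+ ((n ∸ toℕ i) ℕ.+ (n ∸ toℕ j))

  _⊏_ : PosRoot n → PosRoot n → Set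
  α ⊏ β = rank α ℕ.< rank β

  ⊏-wellFounded : WF.WellFounded _⊏_
  ⊏-wellFounded = On.wellFounded rank <-wellFounded

  minus⊏minusʳ : ∀ {i s j} (i<s : i Fin.< s) (i<j : i Fin.< j) → s Fin.< j → minus i s i<s ⊏ minus i j i<j
  minus⊏minusʳ i<s i<j s<j = ℕₚ.∸-monoˡ-< s<j (ℕₚ.<⇒≤ i<s)

  minus⊏minusˡ : ∀ {i s j} (s<j : s Fin.< j) (i<j : i Fin.< j) → i Fin.< s → minus s j s<j ⊏ minus i j i<j
  minus⊏minusˡ s<j i<j i<s = ℕₚ.∸-monoʳ-< i<s (ℕₚ.<⇒≤ s<j)

  minus⊏unit : ∀ {i j} (i<j : i Fin.< j) k → minus i j i<j ⊏ unit k
  minus⊏unit {i} {j} i<j k =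
    ℕₚ.≤-<-trans (ℕₚ.m∸n≤m (toℕ j) (toℕ i)) (ℕₚ.<-≤-trans (Finₚ.toℕ<n j) (ℕₚ.m≤m+n n (n ∸ toℕ k)))

  unit⊏unit : ∀ {i s} → i Fin.< s → unit s ⊏ unit i
  unit⊏unit {i} {s} i<s = ℕₚ.+-monoʳ-< n (ℕₚ.∸-monoʳ-< i<s (ℕₚ.<⇒≤ (Finₚ.toℕ<n s)))

  unit⊏plus : ∀ k {i j} (i<j : i Fin.< j) → unit k ⊏ plus i j i<j
  unit⊏plus k {i} {j} i<j = ℕₚ.≤-<-trans (ℕₚ.+-monoʳ-≤ n (ℕₚ.m∸n≤m n (toℕ k)))
    (ℕₚ.m<m+n (n ℕ.+ n) (ℕₚ.<-≤-trans (ℕₚ.m<n⇒0<n∸m (Finₚ.toℕ<n j)) (ℕₚ.m≤n+m _ _)))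

  minus⊏plus : ∀ {i j k l} (i<j : i Fin.< j) (k<l : k Fin.< l) → minus i j i<j ⊏ plus k l k<l
  minus⊏plus {k = k} i<j k<l = ℕₚ.<-trans (minus⊏unit i<j k) (unit⊏plus k k<l)

  plus⊏plusʳ : ∀ {i j s} (i<s : i Fin.< s) (i<j : i Fin.< j) → j Fin.< s → plus i s i<s ⊏ plus i j i<j
  plus⊏plusʳ {i} {j} {s} i<s i<j j<s =
    ℕₚ.+-monoʳ-< (n ℕ.+ n) (ℕₚ.+-monoʳ-< (n ∸ toℕ i) (ℕₚ.∸-monoʳ-< j<s (ℕₚ.<⇒≤ (Finₚ.toℕ<n s))))

  plus⊏plusˡ : ∀ {i s j} (s<j : s Fin.< j) (i<j : i Fin.< j) → i Fin.< s → plus s j s<j ⊏ plus i j i<j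
  plus⊏plusˡ {i} {s} {j} s<j i<j i<s =
    ℕₚ.+-monoʳ-< (n ℕ.+ n) (ℕₚ.+-monoˡ-< (n ∸ toℕ j) (ℕₚ.∸-monoʳ-< i<s (ℕₚ.<⇒≤ (Finₚ.toℕ<n s))))

module Extension {c ℓ} (F : CharZeroField c ℓ) {n : ℕ} (ρ : W n → LinForm F n) (t : RootType)
                 (H : Pred (PosRoot n) 0ℓ) (hess : IsHessenberg t H)
                 (restricted : InM1 F (restrict t H) ρ) where
  open EdgeConditions F ρ
  open IsHessenberg hess

  ConditionsBelow : PosRoot n → Set _
  ConditionsBelow α = ∀ {β} → β ⊏ α → H β → EdgeCondition β

  condition-below : ∀ {α} → H α → ConditionsBelow α → ∀ β → β ≼[ t ] α → β ⊏ α → EdgeCondition β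
  condition-below {α} Hα ih β β≼α β⊏α = ih β⊏α (lower β α β≼α Hα)

  condition-restricted : ∀ α → H α → IsSimple t α ⊎ IsSimpleReflOfSimple t α → EdgeCondition α
  condition-restricted α Hα α∈H' w w' w'≡ws = restricted w w' α (Hα , α∈H') w'≡ws

  condition-simple : ∀ α → IsSimple t α → EdgeCondition α
  condition-simple α α-simple = condition-restricted α (simple⊆ α α-simple) (inj₁ α-simple)

  minus-condition : ∀ i j (i<j : i Fin.< j) → suc (suc (toℕ i)) ℕ.< toℕ j →
                    H (minus i j i<j) → ConditionsBelow (minus i j i<j) → EdgeCondition (minus i j i<j)
  minus-condition i j i<j i+2<j Hα ih =
    condition-from-factorisations
      (minus-factorisation i s₁ j i<s₁ s₁<j i<j) (minus-factorisation i s₂ j i<s₂ s₂<j i<j)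
      (refl , refl , refl)
      (below (minus i s₁ i<s₁) (minus-≼-minus t i<s₁ i<j ℕₚ.≤-refl (ℕₚ.<⇒≤ s₁<j)) (minus⊏minusʳ i<s₁ i<j s₁<j))
      (below (minus s₁ j s₁<j) (minus-≼-minus t s₁<j i<j (ℕₚ.<⇒≤ i<s₁) ℕₚ.≤-refl) (minus⊏minusˡ s₁<j i<j i<s₁))
      (below (minus i s₂ i<s₂) (minus-≼-minus t i<s₂ i<j ℕₚ.≤-refl (ℕₚ.<⇒≤ s₂<j)) (minus⊏minusʳ i<s₂ i<j s₂<j))
      (below (minus s₂ j s₂<j) (minus-≼-minus t s₂<j i<j (ℕₚ.<⇒≤ i<s₂) ℕₚ.≤-refl) (minus⊏minusˡ s₂<j i<j i<s₂))
      (i≢s₁ ∷ s₂≢s₁ ∷ i≢s₁ ∷ j≢s₁ ∷ s₂≢s₁ ∷ j≢s₁ ∷ [])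
    where
      below = condition-below Hα ih
      j<n = Finₚ.toℕ<n j
      s₁ = Fin.fromℕ< (ℕₚ.<-trans (ℕₚ.n<1+n _) (ℕₚ.<-trans i+2<j j<n))
      s₂ = Fin.fromℕ< (ℕₚ.<-trans i+2<j j<n)
      s₁≡ = Finₚ.toℕ-fromℕ< (ℕₚ.<-trans (ℕₚ.n<1+n _) (ℕₚ.<-trans i+2<j j<n))
      s₂≡ = Finₚ.toℕ-fromℕ< (ℕₚ.<-trans i+2<j j<n)
      i<s₁ : i Fin.< s₁
      i<s₁ = ℕₚ.≤-reflexive (sym s₁≡)
      s₁<s₂ : s₁ Fin.< s₂
      s₁<s₂ = ℕₚ.≤-reflexive (trans (cong suc s₁≡) (sym s₂≡))
      i<s₂ = ℕₚ.<-trans i<s₁ s₁<s₂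
      s₂<j : s₂ Fin.< j
      s₂<j = subst (ℕ._< toℕ j) (sym s₂≡) i+2<j
      s₁<j = ℕₚ.<-trans s₁<s₂ s₂<j
      i≢s₁ = <⇒≢ i<s₁
      s₂≢s₁ = >⇒≢ s₁<s₂
      j≢s₁ = >⇒≢ s₁<j

  unit-condition : ∀ i → suc (suc (toℕ i)) ℕ.< n →
                   H (unit i) → ConditionsBelow (unit i) → EdgeCondition (unit i)
  unit-condition i i+2<n Hα ih =
    condition-from-factorisations (unit-factorisation i s₁ i<s₁) (unit-factorisation i s₂ i<s₂)
      (refl , refl , refl)
      (below (minus i s₁ i<s₁) (minus≼unit t i s₁ i<s₁) (minus⊏unit i<s₁ i))
      (below (unit s₁) (unit-≼-unit t (ℕₚ.<⇒≤ i<s₁)) (unit⊏unit i<s₁))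
      (below (minus i s₂ i<s₂) (minus≼unit t i s₂ i<s₂) (minus⊏unit i<s₂ i))
      (below (unit s₂) (unit-≼-unit t (ℕₚ.<⇒≤ i<s₂)) (unit⊏unit i<s₂))
      (i≢s₁ ∷ s₂≢s₁ ∷ i≢s₁ ∷ i≢s₁ ∷ s₂≢s₁ ∷ i≢s₁ ∷ [])
    where
      below = condition-below Hα ih
      s₁ = Fin.fromℕ< (ℕₚ.<-trans (ℕₚ.n<1+n _) i+2<n)
      s₂ = Fin.fromℕ< i+2<n
      s₁≡ = Finₚ.toℕ-fromℕ< (ℕₚ.<-trans (ℕₚ.n<1+n _) i+2<n)
      s₂≡ = Finₚ.toℕ-fromℕ< i+2<n
      i<s₁ : i Fin.< s₁
      i<s₁ = ℕₚ.≤-reflexive (sym s₁≡)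
      s₁<s₂ : s₁ Fin.< s₂
      s₁<s₂ = ℕₚ.≤-reflexive (trans (cong suc s₁≡) (sym s₂≡))
      i<s₂ = ℕₚ.<-trans i<s₁ s₁<s₂
      i≢s₁ = <⇒≢ i<s₁
      s₂≢s₁ = >⇒≢ s₁<s₂

  plus-condition-above : ∀ i j (i<j : i Fin.< j) → suc (toℕ j) ℕ.< n →
                         H (plus i j i<j) → ConditionsBelow (plus i j i<j) → EdgeCondition (plus i j i<j)
  plus-condition-above i j i<j j+1<n Hα ih =
    condition-from-factorisations (plus-factorisation-above i j s i<j j<s i<s) (plus-factorisation-unit i j i<j)
      (refl , refl , refl)
      (below (plus i s i<s) (plus-≼-plus t i<s i<j ℕₚ.≤-refl (ℕₚ.<⇒≤ j<s)) (plus⊏plusʳ i<s i<j j<s))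
      (condition-simple (minus j s j<s) (minus-simple t j s j<s s≡))
      (below (unit j) (unit≼plus t i j i<j) (unit⊏plus j i<j))
      (below (minus i j i<j) (minus≼plus t i j i<j) (minus⊏plus i<j i<j))
      (j≢s ∷ j≢s ∷ i≢s ∷ j≢s ∷ i≢s ∷ i≢s ∷ [])
    where
      below = condition-below Hα ih
      s = Fin.fromℕ< j+1<n
      s≡ = Finₚ.toℕ-fromℕ< j+1<n
      j<s : j Fin.< s
      j<s = ℕₚ.≤-reflexive (sym s≡)
      i<s = ℕₚ.<-trans i<j j<s
      i≢s = <⇒≢ i<s
      j≢s = <⇒≢ j<s

  plus-condition-below : ∀ i j (i<j : i Fin.< j) → suc (toℕ i) ℕ.< toℕ j →
                         H (plus i j i<j) → ConditionsBelow (plus i j i<j) → EdgeCondition (plus i j i<j)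
  plus-condition-below i j i<j i+1<j Hα ih =
    condition-from-factorisations (plus-factorisation-below i s j i<s s<j i<j) (plus-factorisation-unit i j i<j)
      (refl , refl , refl)
      (condition-simple (minus i s i<s) (minus-simple t i s i<s s≡))
      (below (plus s j s<j) (plus-≼-plus t s<j i<j (ℕₚ.<⇒≤ i<s) ℕₚ.≤-refl) (plus⊏plusˡ s<j i<j i<s))
      (below (unit j) (unit≼plus t i j i<j) (unit⊏plus j i<j))
      (below (minus i j i<j) (minus≼plus t i j i<j) (minus⊏plus i<j i<j))
      (>⇒≢ s<j ∷ >⇒≢ s<j ∷ i≢s ∷ >⇒≢ s<j ∷ i≢s ∷ i≢s ∷ [])
    where
      below = condition-below Hα ih
      s = Fin.fromℕ< (ℕₚ.<-trans i+1<j (Finₚ.toℕ<n j))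
      s≡ = Finₚ.toℕ-fromℕ< (ℕₚ.<-trans i+1<j (Finₚ.toℕ<n j))
      i<s : i Fin.< s
      i<s = ℕₚ.≤-reflexive (sym s≡)
      s<j : s Fin.< j
      s<j = subst (ℕ._< toℕ j) (sym s≡) i+1<j
      i≢s = <⇒≢ i<s

  step : ∀ α → ConditionsBelow α → H α → EdgeCondition α
  step (minus i j i<j) ih Hα with ℕₚ.m≤n⇒m<n∨m≡n i<j
  ... | inj₂ 1+i≡j = condition-simple (minus i j i<j) (minus-simple t i j i<j (sym 1+i≡j))
  ... | inj₁ i+1<j with ℕₚ.m≤n⇒m<n∨m≡n i+1<j
  ...   | inj₁ i+2<j = minus-condition i j i<j i+2<j Hα ih
  ...   | inj₂ 2+i≡j =
    condition-restricted _ Hα (inj₂ (reflection-minus t i s j i<j s≡ (trans (sym 2+i≡j) (cong suc (sym s≡)))))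
    where
      s = Fin.fromℕ< (ℕₚ.<-trans i+1<j (Finₚ.toℕ<n j))
      s≡ = Finₚ.toℕ-fromℕ< (ℕₚ.<-trans i+1<j (Finₚ.toℕ<n j))
  step (unit i) ih Hα with ℕₚ.m≤n⇒m<n∨m≡n (Finₚ.toℕ<n i)
  ... | inj₂ 1+i≡n = condition-simple (unit i) (unit-simple t i 1+i≡n)
  ... | inj₁ i+1<n with ℕₚ.m≤n⇒m<n∨m≡n i+1<n
  ...   | inj₁ i+2<n = unit-condition i i+2<n Hα ih
  ...   | inj₂ 2+i≡n = condition-restricted _ Hα (inj₂ (reflection-unit t i l l≡ (trans (cong suc l≡) 2+i≡n)))
    where
      l = Fin.fromℕ< i+1<n
      l≡ = Finₚ.toℕ-fromℕ< i+1<n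
  step (plus i j i<j) ih Hα with ℕₚ.m≤n⇒m<n∨m≡n (Finₚ.toℕ<n j)
  ... | inj₁ j+1<n = plus-condition-above i j i<j j+1<n Hα ih
  ... | inj₂ 1+j≡n with ℕₚ.m≤n⇒m<n∨m≡n i<j
  ...   | inj₁ i+1<j = plus-condition-below i j i<j i+1<j Hα ih
  ...   | inj₂ 1+i≡j = condition-restricted _ Hα (inj₂ (reflection-plus t i j i<j (sym 1+i≡j) 1+j≡n))

  edge-condition : ∀ α → H α → EdgeCondition α
  edge-condition = WF.All.wfRec ⊏-wellFounded _ (λ α → H α → EdgeCondition α) step

proposition4p2 : ∀ {c ℓ} (F : CharZeroField c ℓ) (n : ℕ) → 2 ≤ n →
                 (t : RootType) (H : Pred (PosRoot n) 0ℓ) → IsHessenberg t H →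
                 (ρ : W n → LinForm F n) →
                 (InM1 F H ρ ⇔ InM1 F (restrict t H) ρ)
proposition4p2 F n _ t H hess ρ = mk⇔
  (λ ρ∈M¹ w w' α α∈H′ → ρ∈M¹ w w' α (proj₁ α∈H′))
  (λ ρ∈M¹′ w w' α α∈H → Extension.edge-condition F ρ t H hess ρ∈M¹′ α α∈H w w')
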